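{- Let $D$ be the derivation of $\mathbb{Q}[W,X,Y,Z]$ with $D(W)=WX$, $D(X)=YZ$, $D(Y)=XZ$, $D(Z)=XY$, and define integers $t_{n,i,j}$ and $r_{n,i,j}$ by $$D^{2n}(W)=W\sum_{i,j\ge0}t_{2n,i,j}X^{2i}Y^jZ^{2n-2i-j},\qquad D^{2n+1}(W)=W\sum_{i,j\ge0}t_{2n+1,i,j}X^{2i+1}Y^jZ^{2n-2i-j},$$ $$D^{2n}(W^2)=W^2\sum_{i,j\ge0}r_{2n,i,j}X^{2i}Y^jZ^{2n-2i-j},\qquad D^{2n+1}(W^2)=W^2\sum_{i,j\ge0}r_{2n+1,i,j}X^{2i+1}Y^jZ^{2n-2i-j}.$$ Then for $n\ge1$: (i) $\sum_{i,j\ge0}t_{n,i,j}=\sum_{i,j\ge0}r_{n-1,i,j}=n!$; (ii) $\sum_{i\ge0}t_{n,i,j}=a_{n-j}(n)$; (iii) $\sum_{j\ge0}t_{n,i,j}=\widetilde P_{n,\lfloor n/2\rfloor-i}$; (iv) $\sum_{i\ge0}r_{n,i,j}=R(n+1,n-j)$; (v) $\sum_{j\ge0}r_{n,i,j}=P_{n+1,\lfloor n/2\rfloor-i}$.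
   Context: $\mathfrak S_n$ is the symmetric group on $[n]$. $P_{n,k}$ is the number of $\pi\in\mathfrak S_n$ with $k$ interior peaks (indices $i\in\{2,\dots,n-1\}$ with $\pi(i-1)<\pi(i)>\pi(i+1)$). $\widetilde P_{n,k}$ is the number of $\pi\in\mathfrak S_n$ with $k$ left peaks (indices $i\in[n-1]$ with $\pi(i-1)<\pi(i)>\pi(i+1)$, where $\pi(0)=0$). A permutation $\pi$ changes direction at $i\in\{2,\dots,n-1\}$ if $\pi(i-1)<\pi(i)>\pi(i+1)$ or $\pi(i-1)>\pi(i)<\pi(i+1)$; it has $k$ alternating runs if it changes direction at exactly $k-1$ positions; $R(n,k)$ is the number of $\pi\in\mathfrak S_n$ with $k$ alternating runs. An alternating subsequence of $\pi$ is a subsequence $\pi(i_1)\pi(i_2)\cdots\pi(i_k)$, $i_1<\dots<i_k$, with $\pi(i_1)>\pi(i_2)<\pi(i_3)>\cdots$; ${\rm as}(\pi)$ is the maximal length of such a subsequence, and $a_k(n)=\#\{\pi\in\mathfrak S_n:{\rm as}(\pi)=k\}$. -}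

module Defs where

open import Data.Bool using (Bool; true; false; _∧_; _∨_; if_then_else_; not)
open import Data.Nat using (ℕ; zero; suc; _+_; _*_; _∸_; _≤ᵇ_; _<ᵇ_; _≡ᵇ_; _⊔_; _/_; _%_)
open import Data.Integer as ℤ using (ℤ; +_)
open import Data.List using (List; []; _∷_; length; filter; map; concatMap; upTo; foldr; _++_)
open import Data.Product using (_×_; _,_)
open import Relation.Nullary.Decidable using (Dec; yes; no)
open import Relation.Binary.PropositionalEquality using (_≡_)
open import Function using (_∘_)

-- Polynomials in ℤ[W,X,Y,Z] (⊆ ℚ[W,X,Y,Z]) as finite formal sums of terms.

-- exponents of W, X, Y, Z
Mon : Set
Mon = ℕ × ℕ × ℕ × ℕ

Poly : Set
Poly = List (ℤ × Mon)

_≟ᵐ_ : Mon → Mon → Bool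
(a , b , c , d) ≟ᵐ (a' , b' , c' , d') =
  (a ≡ᵇ a') ∧ (b ≡ᵇ b') ∧ (c ≡ᵇ c') ∧ (d ≡ᵇ d')

coeff : Poly → Mon → ℤ
coeff [] m = + 0
coeff ((k , m') ∷ p) m = (if m' ≟ᵐ m then k else + 0) ℤ.+ coeff p m

-- The derivation D with D W = W X, D X = Y Z, D Y = X Z, D Z = X Y,
-- applied to a single term via the Leibniz rule:
-- D(W^a X^b Y^c Z^d) = a W^a X^(b+1) Y^c Z^d + b W^a X^(b-1) Y^(c+1) Z^(d+1)
--                    + c W^a X^(b+1) Y^(c-1) Z^(d+1) + d W^a X^(b+1) Y^(c+1) Z^(d-1)
Dterm : ℤ × Mon → Poly
Dterm (k , (a , b , c , d)) =
    (k ℤ.* + a , (a , suc b , c , d))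
  ∷ (k ℤ.* + b , (a , b ∸ 1 , suc c , suc d))
  ∷ (k ℤ.* + c , (a , suc b , c ∸ 1 , suc d))
  ∷ (k ℤ.* + d , (a , suc b , suc c , d ∸ 1))
  ∷ []

D : Poly → Poly
D = concatMap Dterm

D^ : ℕ → Poly → Poly
D^ zero p = p
D^ (suc n) p = D (D^ n p)

Wpoly W²poly : Poly
Wpoly = (+ 1 , (1 , 0 , 0 , 0)) ∷ []
W²poly = (+ 1 , (2 , 0 , 0 , 0)) ∷ []

-- For n = 2m the relevant monomial is X^(2i) Y^j Z^(2m-2i-j);
-- for n = 2m+1 it is X^(2i+1) Y^j Z^(2m-2i-j).  In both cases the
-- X-exponent is 2i + (n mod 2) and the Z-exponent is n - (X-exp) - j.
-- When that Z-exponent would be negative the coefficient is 0.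

xexp : ℕ → ℕ → ℕ
xexp n i = 2 * i + n % 2

coeffW : ℕ → Poly → ℕ → ℕ → ℕ → ℤ
coeffW w p n i j =
  if xexp n i + j ≤ᵇ n
  then coeff p (w , xexp n i , j , n ∸ xexp n i ∸ j)
  else + 0

t : ℕ → ℕ → ℕ → ℤ
t n i j = coeffW 1 (D^ n Wpoly) n i j

r : ℕ → ℕ → ℕ → ℤ
r n i j = coeffW 2 (D^ n W²poly) n i j

Σ< : ℕ → (ℕ → ℤ) → ℤ
Σ< zero f = + 0
Σ< (suc n) f = Σ< n f ℤ.+ f n

-- Permutations of [n] = {1,…,n} in one-line notation.

words : ℕ → ℕ → List (List ℕ)
words n zero = [] ∷ []
words n (suc k) = concatMap (λ x → map (x ∷_) (words n k)) (map suc (upTo n))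

notIn : ℕ → List ℕ → Bool
notIn x [] = true
notIn x (y ∷ ys) = not (x ≡ᵇ y) ∧ notIn x ys

distinct : List ℕ → Bool
distinct [] = true
distinct (x ∷ xs) = notIn x xs ∧ distinct xs

-- 𝔖_n: the injective (hence bijective) words of length n over [n]
Sym : ℕ → List (List ℕ)
Sym n = filter (λ w → Data.Bool._≟_ (distinct w) true) (words n n)
  where import Data.Bool

countStat : (List ℕ → ℕ) → ℕ → ℕ → ℕ
countStat stat n k = length (filter (λ w → Data.Nat._≟_ (stat w) k) (Sym n))
  where import Data.Nat

b2n : Bool → ℕ
b2n true = 1
b2n false = 0

peaks : List ℕ → ℕ
peaks (x ∷ y ∷ z ∷ r) = b2n ((x <ᵇ y) ∧ (z <ᵇ y)) + peaks (y ∷ z ∷ r)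
peaks _ = 0

-- interior peaks: positions i ∈ {2,…,n-1}
ipk : List ℕ → ℕ
ipk = peaks

-- left peaks: positions i ∈ [n-1], with π(0) = 0
lpk : List ℕ → ℕ
lpk w = peaks (0 ∷ w)

changes : List ℕ → ℕ
changes (x ∷ y ∷ z ∷ r) =
  b2n (((x <ᵇ y) ∧ (z <ᵇ y)) ∨ ((y <ᵇ x) ∧ (y <ᵇ z))) + changes (y ∷ z ∷ r)
changes _ = 0

runs : List ℕ → ℕ
runs w = suc (changes w)

subseqs : List ℕ → List (List ℕ)
subseqs [] = [] ∷ []
subseqs (x ∷ xs) = map (x ∷_) (subseqs xs) ++ subseqs xs

altDown altUp : List ℕ → Bool
altDown (x ∷ y ∷ r) = (y <ᵇ x) ∧ altUp (y ∷ r)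
altDown _ = true
altUp (x ∷ y ∷ r) = (x <ᵇ y) ∧ altDown (y ∷ r)
altUp _ = true

maxList : List ℕ → ℕ
maxList = foldr _⊔_ 0

as : List ℕ → ℕ
as w = maxList (map (λ s → if altDown s then length s else 0) (subseqs w))

P : ℕ → ℕ → ℕ
P n k = countStat ipk n k

P̃ : ℕ → ℕ → ℕ
P̃ n k = countStat lpk n k

R : ℕ → ℕ → ℕ
R n k = countStat runs n k

a : ℕ → ℕ → ℕ
a k n = countStat as n k

-- f (m - i), read as 0 when i > m (negative index)
at- : (ℕ → ℕ) → ℕ → ℕ → ℕ
at- f m i = if i ≤ᵇ m then f (m ∸ i) else 0

_! : ℕ → ℕ
zero ! = 1
suc n ! = suc n * n !

module Submission where

open import Defs
open import Data.Bool using (Bool; true; false; _∧_; _∨_; if_then_else_; not; T)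
open import Data.Unit using (⊤; tt)
open import Data.Empty using (⊥; ⊥-elim)
open import Data.Nat using (ℕ; zero; suc; _+_; _*_; _∸_; _≤ᵇ_; _<ᵇ_; _≡ᵇ_; _≤_; _<_; z≤n; s≤s; _/_; _%_)
import Data.Nat as ℕ
import Data.Bool as Bool
open import Data.Nat.Properties
open import Data.Nat.Tactic.RingSolver using (solve-∀)
open import Data.List using (List; []; _∷_; length; map; concatMap; _++_; filter; upTo)
open import Data.List.Properties using (map-++; map-cong; map-cong-local; map-∘; length-map; length-upTo; length-++; filter-notAll; filter-++; ∷-injectiveˡ; ∷-injectiveʳ)
open import Data.List.Relation.Unary.All using (All; []; _∷_)
import Data.List.Relation.Unary.All as All
import Data.List.Relation.Unary.All.Properties as AllP
open import Data.List.Relation.Unary.All.Properties.Core using (¬Any⇒All¬)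
open import Data.List.Relation.Unary.Any using (here; there; any?)
import Data.List.Relation.Unary.Any as Any
open import Data.List.Relation.Unary.Unique.Propositional using (Unique)
import Data.List.Relation.Unary.Unique.Propositional.Properties as UniqueP
open import Data.List.Relation.Unary.AllPairs using ([]; _∷_)
open import Data.List.Membership.Propositional using (_∈_)
open import Data.List.Membership.Propositional.Properties
open import Data.List.Membership.Propositional.Properties.WithK using (unique∧set⇒bag)
open import Data.List.Relation.Binary.BagAndSetEquality using (∼bag⇒↭)
open import Data.List.Relation.Binary.Permutation.Propositional using (_↭_)
open import Data.List.Relation.Binary.Permutation.Propositional.Properties using (↭-length; filter-↭)
open import Data.Product using (_×_; _,_; Σ; ∃; proj₁; proj₂; Σ-syntax)
open import Data.Sum using (_⊎_; inj₁; inj₂)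
open import Relation.Binary.PropositionalEquality
open import Relation.Binary.Definitions using (tri<; tri≈; tri>)
open import Relation.Nullary using (yes; no; ¬_; Dec; ¬?)
open import Function using (_∘_)
open import Function.Bundles using (_⇔_; mk⇔)
open import Data.Nat.ListAction using (sum)
open import Data.Nat.ListAction.Properties using (sum-++)
open import Data.Nat.DivMod using (m≡m%n+[m/n]*n; m%n<n)
open import Data.Integer as Int using (ℤ)
import Data.Integer.Properties as IntP

-- Proof.  (1) D has nonnegative coefficients, so we compute D^n(W^w) as a
-- list of terms with coefficients in ℕ.  Every term of D^n(W^w) has the
-- form W^w X^b Y^c Z^d with b + c + d = n and b ≡ n (mod 2) (`Shaped`).
-- Consequently the row sums Σ_j t_{n,i,j} are the X-marginals (total
-- coefficient of X^(2i + n mod 2)), the column sums are the Y-marginals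
-- and the total sum is the total coefficient sum.  (2) The Leibniz rule
-- gives linear recurrences for these marginals in n; they determine the
-- marginals from their initial values (modules XMarginals, YMarginals).
-- (3) On the permutation side, inserting n + 1 into the n + 1 positions of
-- each π ∈ 𝔖_n lists 𝔖_(n+1) once; the change of lpk, ipk, runs and as
-- under these insertions depends only on the up-down signature of π, and
-- counting the insertions by increment yields the same recurrences
-- (module Recurrence and the `-local` lemmas).  (4) The theorem follows
-- by comparing both sides; the total coefficient sum is multiplied by
-- w + n at each step, giving n! and (n+1)!.

≡ᵇ-true : ∀ {m n} → m ≡ n → (m ≡ᵇ n) ≡ true
≡ᵇ-true {m} {n} m≡n with m ≡ᵇ n | ≡⇒≡ᵇ m n m≡n
... | true | _ = refl

≡ᵇ-false : ∀ {m n} → ¬ m ≡ n → (m ≡ᵇ n) ≡ false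
≡ᵇ-false {m} {n} m≢n with m ≡ᵇ n | ≡ᵇ⇒≡ m n
... | true  | sound = ⊥-elim (m≢n (sound tt))
... | false | _     = refl

≤ᵇ-true : ∀ {m n} → m ≤ n → (m ≤ᵇ n) ≡ true
≤ᵇ-true {m} {n} m≤n with m ≤ᵇ n | ≤⇒≤ᵇ m≤n
... | true | _ = refl

if-0-0 : ∀ (g : Bool) → (if g then 0 else 0) ≡ 0
if-0-0 true  = refl
if-0-0 false = refl

<ᵇ-true : ∀ {m n} → m < n → (m <ᵇ n) ≡ true
<ᵇ-true {m} {n} m<n with m <ᵇ n | <⇒<ᵇ m<n
... | true | _ = refl

<ᵇ-false : ∀ {m n} → ¬ m < n → (m <ᵇ n) ≡ false
<ᵇ-false {m} {n} m≮n with m <ᵇ n | <ᵇ⇒< m n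
... | true  | sound = ⊥-elim (m≮n (sound tt))
... | false | _     = refl

∧-true : ∀ {a b} → a ∧ b ≡ true → a ≡ true × b ≡ true
∧-true {true} {true} _ = refl , refl

true≢false : ∀ {b} → b ≡ true → b ≡ false → ⊥
true≢false refl ()

Σℕ : ℕ → (ℕ → ℕ) → ℕ
Σℕ zero    f = 0
Σℕ (suc N) f = Σℕ N f + f N

sumOver : ∀ {A : Set} → (A → ℕ) → List A → ℕ
sumOver f xs = sum (map f xs)

shuffle : ∀ a b c d → a + b + (c + d) ≡ a + c + (b + d)
shuffle = solve-∀

Σℕ-cong : ∀ N {f g : ℕ → ℕ} → (∀ i → f i ≡ g i) → Σℕ N f ≡ Σℕ N g
Σℕ-cong zero    f≗g = refl
Σℕ-cong (suc N) f≗g = cong₂ _+_ (Σℕ-cong N f≗g) (f≗g N)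

Σℕ-+ : ∀ N (f g : ℕ → ℕ) → Σℕ N (λ i → f i + g i) ≡ Σℕ N f + Σℕ N g
Σℕ-+ zero    f g = refl
Σℕ-+ (suc N) f g rewrite Σℕ-+ N f g = shuffle (Σℕ N f) (Σℕ N g) (f N) (g N)

Σℕ-0 : ∀ N → Σℕ N (λ _ → 0) ≡ 0
Σℕ-0 zero    = refl
Σℕ-0 (suc N) rewrite Σℕ-0 N = refl

Σℕ-miss : ∀ N c k → N ≤ c → Σℕ N (λ j → if c ≡ᵇ j then k else 0) ≡ 0
Σℕ-miss zero    c k _   = refl
Σℕ-miss (suc N) c k N<c rewrite Σℕ-miss N c k (≤-trans (n≤1+n N) N<c)
  | ≡ᵇ-false {c} {N} (λ c≡N → <-irrefl (sym c≡N) N<c) = refl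

Σℕ-hit : ∀ N c k → c < N → Σℕ N (λ j → if c ≡ᵇ j then k else 0) ≡ k
Σℕ-hit (suc N) c k (s≤s c≤N) with c ≟ N
... | yes refl rewrite Σℕ-miss N c k ≤-refl | ≡ᵇ-true {c} refl = refl
... | no c≢N   rewrite Σℕ-hit N c k (≤∧≢⇒< c≤N c≢N) | ≡ᵇ-false c≢N = +-identityʳ k

module _ {A : Set} where

  sumOver-cong : ∀ {f g : A → ℕ} xs → All (λ x → f x ≡ g x) xs → sumOver f xs ≡ sumOver g xs
  sumOver-cong xs f≗g = cong sum (map-cong-local f≗g)

  sumOver-0 : ∀ (xs : List A) → sumOver (λ _ → 0) xs ≡ 0
  sumOver-0 []       = refl
  sumOver-0 (_ ∷ xs) = sumOver-0 xs

  sumOver-+ : ∀ (f g : A → ℕ) xs → sumOver (λ x → f x + g x) xs ≡ sumOver f xs + sumOver g xs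
  sumOver-+ f g []       = refl
  sumOver-+ f g (x ∷ xs) rewrite sumOver-+ f g xs = shuffle (f x) (g x) (sumOver f xs) (sumOver g xs)

  sumOver-* : ∀ α (f : A → ℕ) xs → sumOver (λ x → α * f x) xs ≡ α * sumOver f xs
  sumOver-* α f []       = sym (*-zeroʳ α)
  sumOver-* α f (x ∷ xs) rewrite sumOver-* α f xs = sym (*-distribˡ-+ α (f x) (sumOver f xs))

  Σℕ-sumOver : ∀ N (F : A → ℕ → ℕ) xs → Σℕ N (λ j → sumOver (λ x → F x j) xs) ≡ sumOver (λ x → Σℕ N (F x)) xs
  Σℕ-sumOver N F []       = Σℕ-0 N
  Σℕ-sumOver N F (x ∷ xs) = trans (Σℕ-+ N (F x) _) (cong (_+_ (Σℕ N (F x))) (Σℕ-sumOver N F xs))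

  sumOver-concatMap : ∀ {B : Set} (f : B → ℕ) (g : A → List B) xs →
                      sumOver f (concatMap g xs) ≡ sumOver (λ x → sumOver f (g x)) xs
  sumOver-concatMap f g []       = refl
  sumOver-concatMap f g (x ∷ xs) rewrite map-++ f (g x) (concatMap g xs) | sum-++ (map f (g x)) (map f (concatMap g xs))
    = cong (_+_ (sumOver f (g x))) (sumOver-concatMap f g xs)

-- Polynomials with natural-number coefficients.  D maps them to
-- themselves, so D^n(W^w) can be computed without leaving ℕ; the
-- integer polynomials of Defs are recovered by the embedding `toℤ`.

Termℕ : Set
Termℕ = ℕ × Mon

Polyℕ : Set
Polyℕ = List Termℕ

toℤ : Polyℕ → Poly
toℤ = map λ { (k , m) → (Int.+ k , m) }

Dtermℕ : Termℕ → Polyℕ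
Dtermℕ (k , (a , b , c , d)) =
    (k * a , (a , suc b , c , d))
  ∷ (k * b , (a , b ∸ 1 , suc c , suc d))
  ∷ (k * c , (a , suc b , c ∸ 1 , suc d))
  ∷ (k * d , (a , suc b , suc c , d ∸ 1))
  ∷ []

Dℕ : Polyℕ → Polyℕ
Dℕ = concatMap Dtermℕ

Dℕ^ : ℕ → Polyℕ → Polyℕ
Dℕ^ zero    p = p
Dℕ^ (suc n) p = Dℕ (Dℕ^ n p)

Wpow : ℕ → Polyℕ
Wpow w = (1 , (w , 0 , 0 , 0)) ∷ []

D-toℤ : ∀ p → D (toℤ p) ≡ toℤ (Dℕ p)
D-toℤ [] = refl
D-toℤ ((k , (a , b , c , d)) ∷ p)
  rewrite sym (IntP.pos-* k a) | sym (IntP.pos-* k b) | sym (IntP.pos-* k c) | sym (IntP.pos-* k d)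
        | D-toℤ p = sym (map-++ _ (Dtermℕ (k , (a , b , c , d))) (Dℕ p))

D^-toℤ : ∀ n p → D^ n (toℤ p) ≡ toℤ (Dℕ^ n p)
D^-toℤ zero    p = refl
D^-toℤ (suc n) p rewrite D^-toℤ n p = D-toℤ (Dℕ^ n p)

termCoeff : Mon → Termℕ → ℕ
termCoeff m (k , m') = if m' ≟ᵐ m then k else 0

coeffℕ : Polyℕ → Mon → ℕ
coeffℕ p m = sumOver (termCoeff m) p

coeff-toℤ : ∀ p m → coeff (toℤ p) m ≡ Int.+ coeffℕ p m
coeff-toℤ [] m = refl
coeff-toℤ ((k , m') ∷ p) m rewrite coeff-toℤ p m with m' ≟ᵐ m
... | true  = refl
... | false = refl

coeffXℕ : ℕ → Polyℕ → ℕ → ℕ → ℕ → ℕ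
coeffXℕ w p n x j = if x + j ≤ᵇ n then coeffℕ p (w , x , j , n ∸ x ∸ j) else 0

coeffW-toℤ : ∀ w p n i j → coeffW w (toℤ p) n i j ≡ Int.+ coeffXℕ w p n (xexp n i) j
coeffW-toℤ w p n i j with xexp n i + j ≤ᵇ n
... | true  = coeff-toℤ p _
... | false = refl

t≡coeffXℕ : ∀ n i j → t n i j ≡ Int.+ coeffXℕ 1 (Dℕ^ n (Wpow 1)) n (xexp n i) j
t≡coeffXℕ n i j = trans (cong (λ q → coeffW 1 q n i j) (D^-toℤ n (Wpow 1))) (coeffW-toℤ 1 (Dℕ^ n (Wpow 1)) n i j)

r≡coeffXℕ : ∀ n i j → r n i j ≡ Int.+ coeffXℕ 2 (Dℕ^ n (Wpow 2)) n (xexp n i) j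
r≡coeffXℕ n i j = trans (cong (λ q → coeffW 2 q n i j) (D^-toℤ n (Wpow 2))) (coeffW-toℤ 2 (Dℕ^ n (Wpow 2)) n i j)

parity-step : ∀ n → (n % 2 ≡ 0 × suc n % 2 ≡ 1) ⊎ (n % 2 ≡ 1 × suc n % 2 ≡ 0)
parity-step zero          = inj₁ (refl , refl)
parity-step (suc zero)    = inj₂ (refl , refl)
parity-step (suc (suc n)) = parity-step n

SameParity : ℕ → ℕ → Set
SameParity n b = Σ ℕ λ q → b ≡ 2 * q + n % 2

parity-suc : ∀ n b → SameParity n b → SameParity (suc n) (suc b)
parity-suc n b (q , refl) with parity-step n
... | inj₁ (n0 , n1) rewrite n0 | n1 = q , lemma q
  where
  lemma : ∀ q → suc (2 * q + 0) ≡ 2 * q + 1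
  lemma = solve-∀
... | inj₂ (n0 , n1) rewrite n0 | n1 = suc q , lemma q
  where
  lemma : ∀ q → suc (2 * q + 1) ≡ 2 * suc q + 0
  lemma = solve-∀

parity-pred : ∀ n b → SameParity n (suc b) → SameParity (suc n) b
parity-pred n b (q , e) with parity-step n
parity-pred n b (zero , e)  | inj₁ (n0 , _) rewrite n0 = ⊥-elim (1+n≢0 e)
parity-pred n b (suc q , e) | inj₁ (n0 , n1) rewrite n0 | n1 = q , suc-injective (trans e (lemma q))
  where
  lemma : ∀ q → 2 * suc q + 0 ≡ suc (2 * q + 1)
  lemma = solve-∀
parity-pred n b (q , e)     | inj₂ (n0 , n1) rewrite n0 | n1 = q , suc-injective (trans e (lemma q))
  where
  lemma : ∀ q → 2 * q + 1 ≡ suc (2 * q + 0)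
  lemma = solve-∀

Shaped : ℕ → ℕ → Termℕ → Set
Shaped w n (k , (a , b , c , d)) = k ≡ 0 ⊎ (a ≡ w × b + c + d ≡ n × SameParity n b)

shaped-Dterm : ∀ w n τ → Shaped w n τ → All (Shaped w (suc n)) (Dtermℕ τ)
shaped-Dterm w n (k , _) (inj₁ refl) = inj₁ refl ∷ inj₁ refl ∷ inj₁ refl ∷ inj₁ refl ∷ []
shaped-Dterm w n (k , (a , b , c , d)) (inj₂ (refl , refl , par)) =
  inj₂ (refl , refl , parity-suc n b par) ∷ lowerX b par ∷ lowerY c par ∷ lowerZ d par ∷ []
  where
  lowerX : ∀ b → SameParity (b + c + d) b →
           Shaped w (suc (b + c + d)) (k * b , (a , b ∸ 1 , suc c , suc d))
  lowerX zero    _   = inj₁ (*-zeroʳ k)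
  lowerX (suc b) par = inj₂ (refl , lemma b c d , parity-pred (suc b + c + d) b par)
    where
    lemma : ∀ b c d → b + suc c + suc d ≡ suc (suc b + c + d)
    lemma = solve-∀
  lowerY : ∀ c → SameParity (b + c + d) b →
           Shaped w (suc (b + c + d)) (k * c , (a , suc b , c ∸ 1 , suc d))
  lowerY zero    _   = inj₁ (*-zeroʳ k)
  lowerY (suc c) par = inj₂ (refl , lemma b c d , parity-suc (b + suc c + d) b par)
    where
    lemma : ∀ b c d → suc b + c + suc d ≡ suc (b + suc c + d)
    lemma = solve-∀
  lowerZ : ∀ d → SameParity (b + c + d) b →
           Shaped w (suc (b + c + d)) (k * d , (a , suc b , suc c , d ∸ 1))
  lowerZ zero    _   = inj₁ (*-zeroʳ k)
  lowerZ (suc d) par = inj₂ (refl , lemma b c d , parity-suc (b + c + suc d) b par)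
    where
    lemma : ∀ b c d → suc b + suc c + d ≡ suc (b + c + suc d)
    lemma = solve-∀

shaped-D : ∀ w n p → All (Shaped w n) p → All (Shaped w (suc n)) (Dℕ p)
shaped-D w n []      []       = []
shaped-D w n (τ ∷ p) (s ∷ ss) = AllP.++⁺ (shaped-Dterm w n τ s) (shaped-D w n p ss)

shaped-D^ : ∀ w n → All (Shaped w n) (Dℕ^ n (Wpow w))
shaped-D^ w zero    = inj₂ (refl , refl , 0 , refl) ∷ []
shaped-D^ w (suc n) = shaped-D w n (Dℕ^ n (Wpow w)) (shaped-D^ w n)

Σℕ-hit-parity : ∀ n b k → SameParity n b → b ≤ n →
                Σℕ (suc n) (λ i → if b ≡ᵇ xexp n i then k else 0) ≡ k
Σℕ-hit-parity n b k (q , b≡) b≤n = trans (Σℕ-cong (suc n) same) (Σℕ-hit (suc n) q k q≤n)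
  where
  same : ∀ i → (if b ≡ᵇ xexp n i then k else 0) ≡ (if q ≡ᵇ i then k else 0)
  same i with q ≟ i
  ... | yes refl rewrite ≡ᵇ-true b≡ | ≡ᵇ-true {q} refl = refl
  ... | no q≢i   rewrite ≡ᵇ-false q≢i
    | ≡ᵇ-false {b} {xexp n i} (λ b≡x → q≢i (*-cancelˡ-≡ q i 2
                                  (+-cancelʳ-≡ (n % 2) (2 * q) (2 * i) (trans (sym b≡) b≡x)))) = refl
  q≤n : q < suc n
  q≤n = s≤s (≤-trans (m≤n*m q 2) (≤-trans (m≤m+n (2 * q) (n % 2)) (subst (_≤ n) b≡ b≤n)))

total : Polyℕ → ℕ
total = sumOver proj₁

xPart yPart : ℕ → Termℕ → ℕ
xPart x (k , (a , b , c , d)) = if b ≡ᵇ x then k else 0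
yPart y (k , (a , b , c , d)) = if c ≡ᵇ y then k else 0

xMarginal yMarginal : ℕ → Polyℕ → ℕ
xMarginal x = sumOver (xPart x)
yMarginal y = sumOver (yPart y)

termCoeffX : ℕ → Termℕ → ℕ → ℕ → ℕ → ℕ
termCoeffX w τ n x j = if x + j ≤ᵇ n then termCoeff (w , x , j , n ∸ x ∸ j) τ else 0

coeffXℕ-sumOver : ∀ w p n x j → coeffXℕ w p n x j ≡ sumOver (λ τ → termCoeffX w τ n x j) p
coeffXℕ-sumOver w p n x j with x + j ≤ᵇ n
... | true  = refl
... | false = sym (sumOver-0 p)

degree-∸ : ∀ b c d → b + c + d ∸ b ∸ c ≡ d
degree-∸ b c d rewrite +-assoc b c d | m+n∸m≡n b (c + d) = m+n∸m≡n c d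

-- For a term W^w X^b Y^c Z^d of degree n the guard x + j ≤ n is implied
-- by matching, so the contribution is [b = x]·[c = j]·k.
termCoeffX-shaped : ∀ w n k b c d x j → b + c + d ≡ n →
  termCoeffX w (k , (w , b , c , d)) n x j ≡ (if b ≡ᵇ x then (if c ≡ᵇ j then k else 0) else 0)
termCoeffX-shaped w n k b c d x j refl with b ≟ x | c ≟ j
... | yes refl | yes refl
  rewrite ≤ᵇ-true (m≤m+n (b + c) d) | ≡ᵇ-true {w} refl | ≡ᵇ-true {b} refl | ≡ᵇ-true {c} refl
        | ≡ᵇ-true (sym (degree-∸ b c d)) = refl
... | no b≢x | _ rewrite ≡ᵇ-false b≢x | ≡ᵇ-true {w} refl = if-0-0 (x + j ≤ᵇ b + c + d)
... | yes refl | no c≢j rewrite ≡ᵇ-false c≢j | ≡ᵇ-true {w} refl | ≡ᵇ-true {b} refl = if-0-0 (b + j ≤ᵇ b + c + d)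

termCoeffX-zero : ∀ w m n x j → termCoeffX w (0 , m) n x j ≡ 0
termCoeffX-zero w m n x j with x + j ≤ᵇ n
... | true  = if-0-0 (m ≟ᵐ (w , x , j , n ∸ x ∸ j))
... | false = refl

exponentX≤degree : ∀ b c d n → b + c + d ≡ n → b ≤ n
exponentX≤degree b c d n deg = subst (b ≤_) deg (≤-trans (m≤m+n b c) (m≤m+n (b + c) d))

exponentY≤degree : ∀ b c d n → b + c + d ≡ n → c ≤ n
exponentY≤degree b c d n deg = subst (c ≤_) deg (≤-trans (m≤n+m c b) (m≤m+n (b + c) d))

Σⱼ-termCoeffX : ∀ w n x τ → Shaped w n τ → Σℕ (suc n) (λ j → termCoeffX w τ n x j) ≡ xPart x τ
Σⱼ-termCoeffX w n x (k , (a , b , c , d)) (inj₁ refl) =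
  trans (Σℕ-cong (suc n) (termCoeffX-zero w (a , b , c , d) n x)) (trans (Σℕ-0 (suc n)) (sym (if-0-0 (b ≡ᵇ x))))
Σⱼ-termCoeffX w n x (k , (a , b , c , d)) (inj₂ (refl , deg , _)) =
  trans (Σℕ-cong (suc n) (λ j → termCoeffX-shaped w n k b c d x j deg)) (pick (b ≡ᵇ x))
  where
  pick : ∀ g → Σℕ (suc n) (λ j → if g then (if c ≡ᵇ j then k else 0) else 0) ≡ (if g then k else 0)
  pick true  = Σℕ-hit (suc n) c k (s≤s (exponentY≤degree b c d n deg))
  pick false = Σℕ-0 (suc n)

Σᵢ-termCoeffX : ∀ w n y τ → Shaped w n τ →
                Σℕ (suc n) (λ i → termCoeffX w τ n (xexp n i) y) ≡ yPart y τ
Σᵢ-termCoeffX w n y (k , (a , b , c , d)) (inj₁ refl) =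
  trans (Σℕ-cong (suc n) (λ i → termCoeffX-zero w (a , b , c , d) n (xexp n i) y))
        (trans (Σℕ-0 (suc n)) (sym (if-0-0 (c ≡ᵇ y))))
Σᵢ-termCoeffX w n y (k , (a , b , c , d)) (inj₂ (refl , deg , par))
  rewrite Σℕ-cong (suc n) (λ i → termCoeffX-shaped w n k b c d (xexp n i) y deg) with c ≡ᵇ y
... | true  = Σℕ-hit-parity n b k par (exponentX≤degree b c d n deg)
... | false = trans (Σℕ-cong (suc n) (λ i → if-0-0 (b ≡ᵇ xexp n i))) (Σℕ-0 (suc n))

Σᵢ-xPart : ∀ w n τ → Shaped w n τ → Σℕ (suc n) (λ i → xPart (xexp n i) τ) ≡ proj₁ τ
Σᵢ-xPart w n (k , (a , b , c , d)) (inj₁ refl) =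
  trans (Σℕ-cong (suc n) (λ i → if-0-0 (b ≡ᵇ xexp n i))) (Σℕ-0 (suc n))
Σᵢ-xPart w n (k , (a , b , c , d)) (inj₂ (_ , deg , par)) =
  Σℕ-hit-parity n b k par (exponentX≤degree b c d n deg)

Σⱼ-coeffX : ∀ w n x p → All (Shaped w n) p → Σℕ (suc n) (λ j → coeffXℕ w p n x j) ≡ xMarginal x p
Σⱼ-coeffX w n x p shaped = begin
  Σℕ (suc n) (λ j → coeffXℕ w p n x j)
    ≡⟨ Σℕ-cong (suc n) (coeffXℕ-sumOver w p n x) ⟩
  Σℕ (suc n) (λ j → sumOver (λ τ → termCoeffX w τ n x j) p)
    ≡⟨ Σℕ-sumOver (suc n) (λ τ j → termCoeffX w τ n x j) p ⟩
  sumOver (λ τ → Σℕ (suc n) (termCoeffX w τ n x)) p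
    ≡⟨ sumOver-cong p (All.map (Σⱼ-termCoeffX w n x _) shaped) ⟩
  xMarginal x p ∎
  where open ≡-Reasoning

Σᵢ-coeffX : ∀ w n y p → All (Shaped w n) p →
            Σℕ (suc n) (λ i → coeffXℕ w p n (xexp n i) y) ≡ yMarginal y p
Σᵢ-coeffX w n y p shaped = begin
  Σℕ (suc n) (λ i → coeffXℕ w p n (xexp n i) y)
    ≡⟨ Σℕ-cong (suc n) (λ i → coeffXℕ-sumOver w p n (xexp n i) y) ⟩
  Σℕ (suc n) (λ i → sumOver (λ τ → termCoeffX w τ n (xexp n i) y) p)
    ≡⟨ Σℕ-sumOver (suc n) (λ τ i → termCoeffX w τ n (xexp n i) y) p ⟩
  sumOver (λ τ → Σℕ (suc n) (λ i → termCoeffX w τ n (xexp n i) y)) p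
    ≡⟨ sumOver-cong p (All.map (Σᵢ-termCoeffX w n y _) shaped) ⟩
  yMarginal y p ∎
  where open ≡-Reasoning

Σᵢ-xMarginal : ∀ w n p → All (Shaped w n) p → Σℕ (suc n) (λ i → xMarginal (xexp n i) p) ≡ total p
Σᵢ-xMarginal w n p shaped =
  trans (Σℕ-sumOver (suc n) (λ τ i → xPart (xexp n i) τ) p)
        (sumOver-cong p (All.map (Σᵢ-xPart w n _) shaped))

n≢1+n : ∀ n → ¬ n ≡ suc n
n≢1+n n = 1+n≢n ∘ sym

n≢2+n : ∀ n → ¬ n ≡ suc (suc n)
n≢2+n n e = <-irrefl e (≤-trans (n≤1+n (suc n)) ≤-refl)

pred≢1+n : ∀ n → ¬ n ∸ 1 ≡ suc n
pred≢1+n zero    ()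
pred≢1+n (suc n) e = n≢2+n n e

pred≢-shift : ∀ b x → ¬ b ≡ suc (suc x) → ¬ b ∸ 1 ≡ suc x
pred≢-shift zero    x _   ()
pred≢-shift (suc b) x b≢ e = b≢ (cong suc e)

drop-b : ∀ a b c d → a + (b + c + d) ∸ b ≡ a + c + d
drop-b a b c d = trans (cong (_∸ b) (reorder a b c d)) (m+n∸m≡n b (a + c + d))
  where
  reorder : ∀ a b c d → a + (b + c + d) ≡ b + (a + c + d)
  reorder = solve-∀

drop-c : ∀ b c d → b + c + d ∸ c ≡ b + d
drop-c b c d = trans (cong (_∸ c) (reorder b c d)) (m+n∸m≡n c (b + d))
  where
  reorder : ∀ b c d → b + c + d ≡ c + (b + d)
  reorder = solve-∀

total-Dterm : ∀ w n τ → Shaped w n τ → total (Dtermℕ τ) ≡ (w + n) * proj₁ τ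
total-Dterm w n (k , _) (inj₁ refl) rewrite *-zeroʳ (w + n) = refl
total-Dterm w n (k , (a , b , c , d)) (inj₂ (refl , refl , _)) = lemma k a b c d
  where
  lemma : ∀ k a b c d → k * a + (k * b + (k * c + (k * d + 0))) ≡ (a + (b + c + d)) * k
  lemma = solve-∀

xPart-Dterm-suc : ∀ w n x τ → Shaped w n τ →
  sumOver (xPart (suc x)) (Dtermℕ τ) ≡ (w + n ∸ x) * xPart x τ + (2 + x) * xPart (2 + x) τ
xPart-Dterm-suc w n x (k , (a , b , c , d)) (inj₁ refl)
  rewrite if-0-0 (b ≡ᵇ x) | if-0-0 (b ∸ 1 ≡ᵇ suc x) | if-0-0 (b ≡ᵇ suc (suc x))
        | *-zeroʳ (w + n ∸ x) | *-zeroʳ (2 + x) = refl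
xPart-Dterm-suc w n x (k , (a , b , c , d)) (inj₂ (refl , refl , _)) with b ≟ x
... | yes refl rewrite ≡ᵇ-true {b} refl | ≡ᵇ-false (pred≢1+n b) | ≡ᵇ-false (n≢2+n b)
                     | drop-b a b c d = lemma k a b c d
  where
  lemma : ∀ k a b c d → k * a + (0 + (k * c + (k * d + 0))) ≡ (a + c + d) * k + (2 + b) * 0
  lemma = solve-∀
... | no b≢x rewrite ≡ᵇ-false b≢x with b ≟ suc (suc x)
...   | yes refl rewrite ≡ᵇ-true {suc x} refl = lemma k x (a + (suc (suc x) + c + d) ∸ x)
  where
  lemma : ∀ k x α → 0 + (k * suc (suc x) + (0 + (0 + 0))) ≡ α * 0 + (2 + x) * k
  lemma = solve-∀
...   | no b≢x+2 rewrite ≡ᵇ-false (pred≢-shift b x b≢x+2) | ≡ᵇ-false b≢x+2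
                       | *-zeroʳ (a + (b + c + d) ∸ x) | *-zeroʳ (2 + x) = refl

xPart-Dterm-zero : ∀ τ → sumOver (xPart 0) (Dtermℕ τ) ≡ xPart 1 τ
xPart-Dterm-zero (k , (a , zero , c , d))          rewrite *-zeroʳ k = refl
xPart-Dterm-zero (k , (a , suc zero , c , d))      rewrite *-identityʳ k = +-identityʳ k
xPart-Dterm-zero (k , (a , suc (suc b) , c , d)) = refl

yPart-Dterm-suc : ∀ w n y τ → Shaped w n τ →
  sumOver (yPart (suc y)) (Dtermℕ τ)
    ≡ w * yPart (suc y) τ + (n ∸ y) * yPart y τ + (2 + y) * yPart (2 + y) τ
yPart-Dterm-suc w n y (k , (a , b , c , d)) (inj₁ refl)
  rewrite if-0-0 (c ≡ᵇ suc y) | if-0-0 (c ≡ᵇ y) | if-0-0 (c ∸ 1 ≡ᵇ suc y) | if-0-0 (c ≡ᵇ suc (suc y))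
        | *-zeroʳ w | *-zeroʳ (n ∸ y) | *-zeroʳ (2 + y) = refl
yPart-Dterm-suc w n y (k , (a , b , c , d)) (inj₂ (refl , refl , _)) with c ≟ y
... | yes refl rewrite ≡ᵇ-true {c} refl | ≡ᵇ-false (n≢1+n c) | ≡ᵇ-false (pred≢1+n c)
                     | ≡ᵇ-false (n≢2+n c) | drop-c b c d = lemma k a b c d
  where
  lemma : ∀ k a b c d → 0 + (k * b + (0 + (k * d + 0))) ≡ a * 0 + (b + d) * k + (2 + c) * 0
  lemma = solve-∀
... | no c≢y rewrite ≡ᵇ-false c≢y with c ≟ suc y
...   | yes refl rewrite ≡ᵇ-true {suc y} refl | ≡ᵇ-false (n≢1+n y)
    = lemma k a (b + suc y + d ∸ y) y
  where
  lemma : ∀ k a α y → k * a + (0 + (0 + (0 + 0))) ≡ a * k + α * 0 + (2 + y) * 0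
  lemma = solve-∀
...   | no c≢y+1 rewrite ≡ᵇ-false c≢y+1 with c ≟ suc (suc y)
...     | yes refl rewrite ≡ᵇ-true {suc y} refl = lemma k a (b + suc (suc y) + d ∸ y) y
  where
  lemma : ∀ k a α y → 0 + (0 + (k * suc (suc y) + (0 + 0))) ≡ a * 0 + α * 0 + (2 + y) * k
  lemma = solve-∀
...     | no c≢y+2 rewrite ≡ᵇ-false (pred≢-shift c y c≢y+2) | ≡ᵇ-false c≢y+2
                         | *-zeroʳ a | *-zeroʳ (b + c + d ∸ y) | *-zeroʳ (2 + y) = refl

yPart-Dterm-zero : ∀ w n τ → Shaped w n τ → sumOver (yPart 0) (Dtermℕ τ) ≡ w * yPart 0 τ + yPart 1 τ
yPart-Dterm-zero w n (k , (a , b , c , d)) (inj₁ refl)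
  rewrite if-0-0 (c ≡ᵇ 0) | if-0-0 (c ∸ 1 ≡ᵇ 0) | if-0-0 (c ≡ᵇ 1) | *-zeroʳ w = refl
yPart-Dterm-zero w n (k , (a , b , zero , d)) (inj₂ (refl , refl , _)) = lemma k a
  where
  lemma : ∀ k a → k * a + (0 + (k * 0 + (0 + 0))) ≡ a * k + 0
  lemma = solve-∀
yPart-Dterm-zero w n (k , (a , b , suc zero , d)) (inj₂ (refl , refl , _)) = lemma k a
  where
  lemma : ∀ k a → 0 + (0 + (k * 1 + (0 + 0))) ≡ a * 0 + k
  lemma = solve-∀
yPart-Dterm-zero w n (k , (a , b , suc (suc c) , d)) (inj₂ (refl , refl , _)) rewrite *-zeroʳ a = refl

sumOver-Dℕ : ∀ w n f g p → (∀ τ → Shaped w n τ → sumOver f (Dtermℕ τ) ≡ g τ) →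
            All (Shaped w n) p → sumOver f (Dℕ p) ≡ sumOver g p
sumOver-Dℕ w n f g p rule shaped =
  trans (sumOver-concatMap f Dtermℕ p) (sumOver-cong p (All.map (λ {τ} → rule τ) shaped))

total-D : ∀ w n p → All (Shaped w n) p → total (Dℕ p) ≡ (w + n) * total p
total-D w n p shaped =
  trans (sumOver-Dℕ w n proj₁ _ p (total-Dterm w n) shaped) (sumOver-* (w + n) proj₁ p)

xMarginal-D-suc : ∀ w n x p → All (Shaped w n) p →
  xMarginal (suc x) (Dℕ p) ≡ (w + n ∸ x) * xMarginal x p + (2 + x) * xMarginal (2 + x) p
xMarginal-D-suc w n x p shaped = begin
  xMarginal (suc x) (Dℕ p)
    ≡⟨ sumOver-Dℕ w n (xPart (suc x)) _ p (xPart-Dterm-suc w n x) shaped ⟩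
  sumOver (λ τ → (w + n ∸ x) * xPart x τ + (2 + x) * xPart (2 + x) τ) p
    ≡⟨ sumOver-+ _ _ p ⟩
  sumOver (λ τ → (w + n ∸ x) * xPart x τ) p + sumOver (λ τ → (2 + x) * xPart (2 + x) τ) p
    ≡⟨ cong₂ _+_ (sumOver-* (w + n ∸ x) (xPart x) p) (sumOver-* (2 + x) (xPart (2 + x)) p) ⟩
  (w + n ∸ x) * xMarginal x p + (2 + x) * xMarginal (2 + x) p ∎
  where open ≡-Reasoning

xMarginal-D-zero : ∀ p → xMarginal 0 (Dℕ p) ≡ xMarginal 1 p
xMarginal-D-zero p = trans (sumOver-concatMap (xPart 0) Dtermℕ p) (cong sum (map-cong xPart-Dterm-zero p))

yMarginal-D-suc : ∀ w n y p → All (Shaped w n) p →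
  yMarginal (suc y) (Dℕ p)
    ≡ w * yMarginal (suc y) p + (n ∸ y) * yMarginal y p + (2 + y) * yMarginal (2 + y) p
yMarginal-D-suc w n y p shaped = begin
  yMarginal (suc y) (Dℕ p)
    ≡⟨ sumOver-Dℕ w n (yPart (suc y)) _ p (yPart-Dterm-suc w n y) shaped ⟩
  sumOver (λ τ → w * yPart (suc y) τ + (n ∸ y) * yPart y τ + (2 + y) * yPart (2 + y) τ) p
    ≡⟨ trans (sumOver-+ _ _ p) (cong (_+ _) (sumOver-+ _ _ p)) ⟩
  sumOver (λ τ → w * yPart (suc y) τ) p + sumOver (λ τ → (n ∸ y) * yPart y τ) p
    + sumOver (λ τ → (2 + y) * yPart (2 + y) τ) p
    ≡⟨ cong₂ _+_ (cong₂ _+_ (sumOver-* w (yPart (suc y)) p) (sumOver-* (n ∸ y) (yPart y) p))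
                 (sumOver-* (2 + y) (yPart (2 + y)) p) ⟩
  w * yMarginal (suc y) p + (n ∸ y) * yMarginal y p + (2 + y) * yMarginal (2 + y) p ∎
  where open ≡-Reasoning

yMarginal-D-zero : ∀ w n p → All (Shaped w n) p → yMarginal 0 (Dℕ p) ≡ w * yMarginal 0 p + yMarginal 1 p
yMarginal-D-zero w n p shaped =
  trans (sumOver-Dℕ w n (yPart 0) _ p (yPart-Dterm-zero w n) shaped)
        (trans (sumOver-+ _ _ p) (cong (_+ yMarginal 1 p) (sumOver-* w (yPart 0) p)))

xMarginal-vanish : ∀ w n x p → All (Shaped w n) p → n < x → xMarginal x p ≡ 0
xMarginal-vanish w n x p shaped n<x = trans (sumOver-cong p (All.map vanish shaped)) (sumOver-0 p)
  where
  vanish : ∀ {τ} → Shaped w n τ → xPart x τ ≡ 0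
  vanish {k , (a , b , c , d)} (inj₁ refl) = if-0-0 (b ≡ᵇ x)
  vanish {k , (a , b , c , d)} (inj₂ (_ , deg , _))
    rewrite ≡ᵇ-false {b} {x} (λ b≡x → <-irrefl b≡x (≤-<-trans (exponentX≤degree b c d n deg) n<x)) = refl

yMarginal-vanish : ∀ w n y p → All (Shaped w n) p → n < y → yMarginal y p ≡ 0
yMarginal-vanish w n y p shaped n<y = trans (sumOver-cong p (All.map vanish shaped)) (sumOver-0 p)
  where
  vanish : ∀ {τ} → Shaped w n τ → yPart y τ ≡ 0
  vanish {k , (a , b , c , d)} (inj₁ refl) = if-0-0 (c ≡ᵇ y)
  vanish {k , (a , b , c , d)} (inj₂ (_ , deg , _))
    rewrite ≡ᵇ-false {c} {y} (λ c≡y → <-irrefl c≡y (≤-<-trans (exponentY≤degree b c d n deg) n<y)) = refl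

-- The X-marginals of D^n(W^w) are determined by their recurrence: an
-- array c(n,k) with the same initial values and the recurrence
--   c(n+1,0) = w·c(n,0),
--   c(n+1,k+1) = (w + 2(k+1))·c(n,k+1) + (n - 2k)·c(n,k)
-- is the X-marginal at the exponent x = n - 2k.  (This is the
-- recurrence of xMarginal-D-suc/-zero, re-indexed by k = (n - x)/2.)
module XMarginals (w : ℕ) (c : ℕ → ℕ → ℕ)
  (c-init   : c 0 0 ≡ 1)
  (c-init-0 : ∀ k → c 0 (suc k) ≡ 0)
  (c-rec-0  : ∀ n → c (suc n) 0 ≡ w * c n 0)
  (c-rec    : ∀ n k → c (suc n) (suc k) ≡ (w + 2 * suc k) * c n (suc k) + (n ∸ 2 * k) * c n k)
  where

  private
    p : ℕ → Polyℕ
    p n = Dℕ^ n (Wpow w)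

    2*suc : ∀ k → 2 * suc k ≡ suc (suc (2 * k))
    2*suc = solve-∀

    shift : ∀ x k → suc (suc x) + 2 * k ≡ x + 2 * suc k
    shift = solve-∀

    shift-∸ : ∀ x k → x + 2 * suc k ∸ 2 * k ≡ suc (suc x)
    shift-∸ x k = trans (cong (_∸ 2 * k) (sym (shift x k))) (m+n∸n≡m (suc (suc x)) (2 * k))

    drop-middle : ∀ a b c → a + (b + c) ∸ b ≡ a + c
    drop-middle a b c = trans (cong (_∸ b) (reorder a b c)) (m+n∸m≡n b (a + c))
      where
      reorder : ∀ a b c → a + (b + c) ≡ b + (a + c)
      reorder = solve-∀

  -- c(n,k) = 0 once 2k > n, like an X-marginal at a negative exponent.
  c-vanish : ∀ n k → n < 2 * k → c n k ≡ 0
  c-vanish zero    (suc k) _ = c-init-0 k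
  c-vanish (suc n) (suc k) n<2k
    rewrite c-rec n k | c-vanish n (suc k) (<-trans (n<1+n n) n<2k)
          | m≤n⇒m∸n≡0 {n} {2 * k} (≤-pred (≤-pred (subst (suc n <_) (2*suc k) n<2k)))
          | *-zeroʳ (w + 2 * suc k) = refl

  xMarginal-step : ∀ n → (∀ x k → x + 2 * k ≡ n → xMarginal x (p n) ≡ c n k) →
                   ∀ x k → x + 2 * k ≡ suc n → xMarginal x (p (suc n)) ≡ c (suc n) k
  -- Top exponent x + 1 = n + 1: only X^x contributes, with factor w.
  xMarginal-step n IH (suc x) zero e with suc-injective (trans (sym (+-identityʳ (suc x))) e)
  ... | refl rewrite xMarginal-D-suc w x x (p x) (shaped-D^ w x) | IH x 0 (+-identityʳ x)
        | xMarginal-vanish w x (suc (suc x)) (p x) (shaped-D^ w x) (≤-trans (n<1+n x) (n≤1+n (suc x)))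
        | c-rec-0 x | m+n∸n≡m w x | *-zeroʳ (suc (suc x)) = +-identityʳ _
  -- Interior exponent: X^x and X^(x+2) contribute.
  xMarginal-step n IH (suc x) (suc k) e with suc-injective e
  ... | refl rewrite xMarginal-D-suc w (x + 2 * suc k) x (p (x + 2 * suc k)) (shaped-D^ w (x + 2 * suc k))
        | IH x (suc k) refl | IH (suc (suc x)) k (shift x k)
        | c-rec (x + 2 * suc k) k | drop-middle w x (2 * suc k) | shift-∸ x k = refl
  -- Exponent 0: only X^1 contributes, and c(n,k+1) = 0 for n = 2k + 1.
  xMarginal-step n IH zero (suc k) e with suc-injective (trans (sym (2*suc k)) e)
  ... | refl rewrite xMarginal-D-zero (p (suc (2 * k))) | IH 1 k refl
        | c-rec (suc (2 * k)) k | c-vanish (suc (2 * k)) (suc k) (subst (suc (2 * k) <_) (sym (2*suc k)) ≤-refl)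
        | *-zeroʳ (w + 2 * suc k) | m+n∸n≡m 1 (2 * k) = sym (+-identityʳ _)

  xMarginal≡ : ∀ n x k → x + 2 * k ≡ n → xMarginal x (p n) ≡ c n k
  xMarginal≡ zero    zero zero    refl = sym c-init
  xMarginal≡ zero    zero (suc k) e    = ⊥-elim (1+n≢0 (trans (sym (2*suc k)) e))
  xMarginal≡ (suc n) x    k       e    = xMarginal-step n (xMarginal≡ n) x k e

-- Likewise the Y-marginals of D^n(W^w), n ≥ 1, are determined by their
-- recurrence: an array c(n,k) with c(1,·) = (0, w, 0, 0, …) and, for n ≥ 1,
--   c(n+1,0) = 0,   c(n+1,1) = c(n,1) + w·c(n,0),
--   c(n+1,k+2) = (k+2)·c(n,k+2) + w·c(n,k+1) + (n - k)·c(n,k)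
-- is the Y-marginal at the exponent y = n - k.  (This is the recurrence
-- of yMarginal-D-suc/-zero, re-indexed by k = n - y.)
module YMarginals (w : ℕ) (c : ℕ → ℕ → ℕ)
  (c-init-0 : c 1 0 ≡ 0)
  (c-init-1 : c 1 1 ≡ w)
  (c-init-2 : ∀ k → c 1 (suc (suc k)) ≡ 0)
  (c-rec-0  : ∀ n → 1 ≤ n → c (suc n) 0 ≡ 0)
  (c-rec-1  : ∀ n → 1 ≤ n → c (suc n) 1 ≡ c n 1 + w * c n 0)
  (c-rec    : ∀ n → 1 ≤ n → ∀ k →
              c (suc n) (suc (suc k)) ≡ suc (suc k) * c n (suc (suc k)) + w * c n (suc k) + (n ∸ k) * c n k)
  where

  private
    p : ℕ → Polyℕ
    p n = Dℕ^ n (Wpow w)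

    shift : ∀ y k → suc (suc y) + k ≡ y + suc (suc k)
    shift = solve-∀

    shift-∸ : ∀ y k → y + suc (suc k) ∸ k ≡ suc (suc y)
    shift-∸ y k = trans (cong (_∸ k) (sym (shift y k))) (m+n∸n≡m (suc (suc y)) k)

  -- c(n+1,k) = 0 once k > n + 1, like a Y-marginal at a negative exponent.
  c-vanish : ∀ n k → suc n < k → c (suc n) k ≡ 0
  c-vanish zero    (suc (suc k)) _ = c-init-2 k
  c-vanish zero    (suc zero)    (s≤s ())
  c-vanish (suc n) (suc (suc k)) (s≤s (s≤s n<k))
    rewrite c-rec (suc n) (s≤s z≤n) k | c-vanish n (suc (suc k)) (s≤s (s≤s (≤-trans (n≤1+n n) n<k)))
          | c-vanish n (suc k) (s≤s n<k) | m≤n⇒m∸n≡0 {suc n} {k} n<k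
          | *-zeroʳ (suc (suc k)) | *-zeroʳ w = refl

  -- The initial values, read off D(W^w) = w·W^w X.
  yMarginal-init-0 : yMarginal 0 (p 1) ≡ c 1 1
  yMarginal-init-0 = trans (+-identityʳ (w + 0)) (trans (+-identityʳ w) (sym c-init-1))

  yMarginal-init-1 : yMarginal 1 (p 1) ≡ c 1 0
  yMarginal-init-1 = sym c-init-0

  yMarginal-step : ∀ N → 1 ≤ N → (∀ y k → y + k ≡ N → yMarginal y (p N) ≡ c N k) →
                   ∀ y k → y + k ≡ suc N → yMarginal y (p (suc N)) ≡ c (suc N) k
  -- Top exponent y + 1 = N + 1: no term of degree N contributes.
  yMarginal-step N 1≤N IH (suc y) zero e with suc-injective (trans (sym (+-identityʳ (suc y))) e)
  ... | refl rewrite yMarginal-D-suc w y y (p y) (shaped-D^ w y) | c-rec-0 y 1≤N | n∸n≡0 y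
        | yMarginal-vanish w y (suc y) (p y) (shaped-D^ w y) ≤-refl
        | yMarginal-vanish w y (suc (suc y)) (p y) (shaped-D^ w y) (≤-trans (n<1+n y) (n≤1+n (suc y)))
        | *-zeroʳ w | *-zeroʳ (suc (suc y)) = refl
  -- Exponent y + 1 = N: Y^(y+1) and Y^y contribute.
  yMarginal-step N 1≤N IH (suc y) (suc zero) e with suc-injective (trans (+-comm 1 (suc y)) e)
  ... | refl rewrite yMarginal-D-suc w (suc y) y (p (suc y)) (shaped-D^ w (suc y)) | c-rec-1 (suc y) 1≤N
        | IH (suc y) 0 (+-identityʳ (suc y)) | IH y 1 (+-comm y 1) | m+n∸n≡m 1 y
        | yMarginal-vanish w (suc y) (suc (suc y)) (p (suc y)) (shaped-D^ w (suc y)) ≤-refl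
        | *-zeroʳ (suc (suc y)) = lemma (c (suc y) 1) (c (suc y) 0) w
    where
    lemma : ∀ a b w → w * b + 1 * a + 0 ≡ a + w * b
    lemma = solve-∀
  -- Interior exponent: Y^(y+1), Y^y and Y^(y+2) contribute.
  yMarginal-step N 1≤N IH (suc y) (suc (suc k)) e with suc-injective e
  ... | refl rewrite yMarginal-D-suc w (y + suc (suc k)) y (p (y + suc (suc k))) (shaped-D^ w (y + suc (suc k)))
        | c-rec (y + suc (suc k)) 1≤N k
        | IH (suc y) (suc k) (sym (+-suc y (suc k))) | IH y (suc (suc k)) refl | IH (suc (suc y)) k (shift y k)
        | m+n∸m≡n y (suc (suc k)) | shift-∸ y k
    = lemma (c (y + suc (suc k)) (suc k)) (c (y + suc (suc k)) (suc (suc k))) (c (y + suc (suc k)) k) w y k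
    where
    lemma : ∀ a b c w y k → w * a + suc (suc k) * b + suc (suc y) * c ≡ suc (suc k) * b + w * a + suc (suc y) * c
    lemma = solve-∀
  -- Exponent 0: Y^0 and Y^1 contribute.
  yMarginal-step (suc N) 1≤N IH zero (suc k) e with suc-injective e
  ... | refl rewrite yMarginal-D-zero w (suc N) (p (suc N)) (shaped-D^ w (suc N))
        | c-rec (suc N) 1≤N N | IH 0 (suc N) refl | IH 1 N refl
        | c-vanish N (suc (suc N)) ≤-refl | *-zeroʳ (suc (suc N)) | m+n∸n≡m 1 N
    = lemma (c (suc N) (suc N)) (c (suc N) N) w
    where
    lemma : ∀ a b w → w * a + b ≡ 0 + w * a + (1 + 0) * b
    lemma = solve-∀

  yMarginal≡ : ∀ n y k → y + k ≡ suc n → yMarginal y (p (suc n)) ≡ c (suc n) k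
  yMarginal≡ zero    zero       (suc zero) refl = yMarginal-init-0
  yMarginal≡ zero    (suc zero) zero       refl = yMarginal-init-1
  yMarginal≡ (suc n) y          k          e    = yMarginal-step (suc n) (s≤s z≤n) (yMarginal≡ n) y k e

-- A word w₁ w₂ … w_m with distinct neighbours is
-- described by the Booleans (w₁ < w₂, w₂ < w₃, …): true is an ascent,
-- false a descent.  All statistics of the theorem are functions of the
-- signature, computed here.  `nextDown s`/`nextUp s`: s starts with a
-- descent/an ascent.
nextDown nextUp : List Bool → Bool
nextDown [] = false
nextDown (d ∷ _) = not d
nextUp [] = false
nextUp (d ∷ _) = d

peakAt : Bool → List Bool → ℕ
peakAt b s = b2n (b ∧ nextDown s)

peaksˢ : List Bool → ℕ
peaksˢ [] = 0
peaksˢ (b ∷ r) = peakAt b r + peaksˢ r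

changeAt : Bool → List Bool → ℕ
changeAt b s = b2n (if b then nextDown s else nextUp s)

changesˢ : List Bool → ℕ
changesˢ [] = 0
changesˢ (b ∷ r) = changeAt b r + changesˢ r

endsUp : List Bool → ℕ
endsUp [] = 0
endsUp (b ∷ []) = b2n b
endsUp (b ∷ c ∷ r) = endsUp (c ∷ r)

-- Inserting a letter larger than all others into a word x τ, at each of
-- the positions after x, replaces the signature s of x τ by the members
-- of `insertedSigs s` (the new letter creates an ascent followed by a
-- descent, or ends the word with an ascent).
insertedSigs : List Bool → List (List Bool)
insertedSigs [] = (true ∷ []) ∷ []
insertedSigs (b ∷ s) = (true ∷ false ∷ s) ∷ map (b ∷_) (insertedSigs s)

-- All insertion positions: in front of the word the new letter creates a
-- descent.
allInsertedSigs : List Bool → List (List Bool)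
allInsertedSigs s = (false ∷ s) ∷ insertedSigs s

-- The increments of the number of peaks caused by the insertions after
-- the first letter of a word with signature b ∷ s, listed in the order
-- of `insertedSigs s`; see Δpeaks-correct.
Δpeaks-head : Bool → Bool → List Bool → ℕ
Δpeaks-head b c s' = if (b ∧ not c) ∨ (c ∧ nextDown s') then 0 else 1

Δpeaks : Bool → List Bool → List ℕ
Δpeaks b [] = 0 ∷ []
Δpeaks b (c ∷ s') = Δpeaks-head b c s' ∷ Δpeaks c s'

Δchanges-head : Bool → Bool → List Bool → ℕ
Δchanges-head b c s' = (b2n (not b) + 1 + changeAt false s') ∸ (changeAt b (c ∷ []) + changeAt c s')

Δchanges : Bool → List Bool → List ℕ
Δchanges b [] = (if b then 0 else 1) ∷ []
Δchanges b (c ∷ s') = Δchanges-head b c s' ∷ Δchanges c s'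

map-+-assoc : ∀ K Q (d : List ℕ) → map (K +_) (map (Q +_) d) ≡ map ((K + Q) +_) d
map-+-assoc K Q d = trans (sym (map-∘ d)) (map-cong (λ v → sym (+-assoc K Q v)) d)

Δpeaks-head-correct : ∀ b c s' X → peakAt b (true ∷ []) + (1 + (peakAt false s' + X)) ≡ (peakAt b (c ∷ []) + (peakAt c s' + X)) + Δpeaks-head b c s'
Δpeaks-head-correct true true [] X = +-comm 1 X
Δpeaks-head-correct true true (true ∷ s) X = +-comm 1 X
Δpeaks-head-correct true true (false ∷ s) X = sym (+-identityʳ (suc X))
Δpeaks-head-correct true false s' X = sym (+-identityʳ (suc X))
Δpeaks-head-correct false true [] X = +-comm 1 X
Δpeaks-head-correct false true (true ∷ s) X = +-comm 1 X
Δpeaks-head-correct false true (false ∷ s) X = sym (+-identityʳ (suc X))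
Δpeaks-head-correct false false s' X = +-comm 1 X

Δpeaks-correct : ∀ b s → map (λ w → peaksˢ (b ∷ w)) (insertedSigs s) ≡ map (peaksˢ (b ∷ s) +_) (Δpeaks b s)
Δpeaks-correct true [] = refl
Δpeaks-correct false [] = refl
Δpeaks-correct b (c ∷ s') = cong₂ _∷_ (Δpeaks-head-correct b c s' (peaksˢ s'))
  (begin
    map (λ w → peaksˢ (b ∷ w)) (map (c ∷_) (insertedSigs s'))
      ≡⟨ sym (map-∘ (insertedSigs s')) ⟩
    map (λ w → peakAt b (c ∷ []) + peaksˢ (c ∷ w)) (insertedSigs s')
      ≡⟨ map-∘ (insertedSigs s') ⟩
    map (peakAt b (c ∷ []) +_) (map (λ w → peaksˢ (c ∷ w)) (insertedSigs s'))
      ≡⟨ cong (map (peakAt b (c ∷ []) +_)) (Δpeaks-correct c s') ⟩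
    map (peakAt b (c ∷ []) +_) (map (peaksˢ (c ∷ s') +_) (Δpeaks c s'))
      ≡⟨ map-+-assoc (peakAt b (c ∷ [])) (peaksˢ (c ∷ s')) (Δpeaks c s') ⟩
    map (peaksˢ (b ∷ c ∷ s') +_) (Δpeaks c s') ∎)
  where open ≡-Reasoning

rearrange : ∀ a b c X → a ≡ b + c → a + X ≡ b + X + c
rearrange a b c X refl = lemma b c X
  where
  lemma : ∀ b c X → b + c + X ≡ b + X + c
  lemma = solve-∀

Δchanges-head-correct : ∀ b c s' X → changeAt b (true ∷ []) + (1 + (changeAt false s' + X)) ≡ (changeAt b (c ∷ []) + (changeAt c s' + X)) + Δchanges-head b c s'
Δchanges-head-correct true true [] X = rearrange 1 0 1 X refl
Δchanges-head-correct true true (true ∷ s) X = rearrange 2 0 2 X refl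
Δchanges-head-correct true true (false ∷ s) X = rearrange 1 1 0 X refl
Δchanges-head-correct true false [] X = rearrange 1 1 0 X refl
Δchanges-head-correct true false (true ∷ s) X = rearrange 2 2 0 X refl
Δchanges-head-correct true false (false ∷ s) X = rearrange 1 1 0 X refl
Δchanges-head-correct false true [] X = rearrange 2 1 1 X refl
Δchanges-head-correct false true (true ∷ s) X = rearrange 3 1 2 X refl
Δchanges-head-correct false true (false ∷ s) X = rearrange 2 2 0 X refl
Δchanges-head-correct false false [] X = rearrange 2 0 2 X refl
Δchanges-head-correct false false (true ∷ s) X = rearrange 3 1 2 X refl
Δchanges-head-correct false false (false ∷ s) X = rearrange 2 0 2 X refl

Δchanges-correct : ∀ b s → map (λ w → changesˢ (b ∷ w)) (insertedSigs s) ≡ map (changesˢ (b ∷ s) +_) (Δchanges b s)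
Δchanges-correct true [] = refl
Δchanges-correct false [] = refl
Δchanges-correct b (c ∷ s') = cong₂ _∷_ (Δchanges-head-correct b c s' (changesˢ s'))
  (begin
    map (λ w → changesˢ (b ∷ w)) (map (c ∷_) (insertedSigs s'))
      ≡⟨ sym (map-∘ (insertedSigs s')) ⟩
    map (λ w → changeAt b (c ∷ []) + changesˢ (c ∷ w)) (insertedSigs s')
      ≡⟨ map-∘ (insertedSigs s') ⟩
    map (changeAt b (c ∷ []) +_) (map (λ w → changesˢ (c ∷ w)) (insertedSigs s'))
      ≡⟨ cong (map (changeAt b (c ∷ []) +_)) (Δchanges-correct c s') ⟩
    map (changeAt b (c ∷ []) +_) (map (changesˢ (c ∷ s') +_) (Δchanges c s'))
      ≡⟨ map-+-assoc (changeAt b (c ∷ [])) (changesˢ (c ∷ s')) (Δchanges c s') ⟩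
    map (changesˢ (b ∷ c ∷ s') +_) (Δchanges c s') ∎)
  where open ≡-Reasoning

-- occ k l: the number of entries of l equal to k.  The recurrences for
-- the permutation statistics are obtained by counting how many
-- insertions raise a statistic by 0, 1 or 2.
occ : ℕ → List ℕ → ℕ
occ k [] = 0
occ k (v ∷ l) = (if v ≡ᵇ k then 1 else 0) + occ k l

-- The first increment vanishes exactly when the inserted letter's
-- neighbourhood already contained one of the two (exclusive) peaks.
Δpeaks-head-zero : ∀ b c f → (if (if (b ∧ not c) ∨ (c ∧ f) then 0 else 1) ≡ᵇ 0 then 1 else 0) ≡ b2n (b ∧ not c) + b2n (c ∧ f)
Δpeaks-head-zero true true true = refl
Δpeaks-head-zero true true false = refl
Δpeaks-head-zero true false f = refl
Δpeaks-head-zero false true true = refl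
Δpeaks-head-zero false true false = refl
Δpeaks-head-zero false false f = refl

occ0-Δpeaks : ∀ b s → occ 0 (Δpeaks b s) ≡ 1 + peaksˢ (b ∷ s) + peaksˢ s
occ0-Δpeaks true [] = refl
occ0-Δpeaks false [] = refl
occ0-Δpeaks b (c ∷ s') rewrite Δpeaks-head-zero b c (nextDown s') | occ0-Δpeaks c s' =
  arith (b2n (b ∧ not c)) (b2n (c ∧ nextDown s')) (peaksˢ s')
  where
  arith : ∀ P Q X → P + Q + (1 + (Q + X) + X) ≡ 1 + (P + (Q + X)) + (Q + X)
  arith = solve-∀

Δpeaks≤1 : ∀ b s → All (_≤ 1) (Δpeaks b s)
Δpeaks≤1 b [] = z≤n ∷ []
Δpeaks≤1 b (c ∷ s') = byCases (b ∧ not c ∨ c ∧ nextDown s') ∷ Δpeaks≤1 c s'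
  where
  byCases : ∀ g → (if g then 0 else 1) ≤ 1
  byCases true = z≤n
  byCases false = s≤s z≤n

length-Δpeaks : ∀ b s → length (Δpeaks b s) ≡ suc (length s)
length-Δpeaks b [] = refl
length-Δpeaks b (c ∷ s') = cong suc (length-Δpeaks c s')

occ0-Δchanges : ∀ b s → occ 0 (Δchanges b s) ≡ peaksˢ (b ∷ s) + peaksˢ s + endsUp (b ∷ s)
occ0-Δchanges true [] = refl
occ0-Δchanges false [] = refl
occ0-Δchanges b (c ∷ s') rewrite occ0-Δchanges c s' = byCases b c s'
  where
  arith : ∀ P Q X Lt → P + Q + (Q + X + X + Lt) ≡ P + (Q + X) + (Q + X) + Lt
  arith = solve-∀
  byCases : ∀ b c s' → (if Δchanges-head b c s' ≡ᵇ 0 then 1 else 0) + (peaksˢ (c ∷ s') + peaksˢ s' + endsUp (c ∷ s'))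
                 ≡ peaksˢ (b ∷ c ∷ s') + peaksˢ (c ∷ s') + endsUp (c ∷ s')
  byCases true true [] = refl
  byCases true true (true ∷ s) = arith 0 0 (peaksˢ (true ∷ s)) (endsUp (true ∷ true ∷ s))
  byCases true true (false ∷ s) = arith 0 1 (peaksˢ (false ∷ s)) (endsUp (true ∷ false ∷ s))
  byCases true false [] = refl
  byCases true false (true ∷ s) = arith 1 0 (peaksˢ (true ∷ s)) (endsUp (false ∷ true ∷ s))
  byCases true false (false ∷ s) = arith 1 0 (peaksˢ (false ∷ s)) (endsUp (false ∷ false ∷ s))
  byCases false true [] = refl
  byCases false true (true ∷ s) = arith 0 0 (peaksˢ (true ∷ s)) (endsUp (true ∷ true ∷ s))
  byCases false true (false ∷ s) = arith 0 1 (peaksˢ (false ∷ s)) (endsUp (true ∷ false ∷ s))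
  byCases false false [] = refl
  byCases false false (true ∷ s) = arith 0 0 (peaksˢ (true ∷ s)) (endsUp (false ∷ true ∷ s))
  byCases false false (false ∷ s) = arith 0 0 (peaksˢ (false ∷ s)) (endsUp (false ∷ false ∷ s))

occ1-Δchanges-value : Bool → List Bool → ℕ
occ1-Δchanges-value b [] = if b then 0 else 1
occ1-Δchanges-value b (_ ∷ _) = 1

occ1-Δchanges : ∀ b s → occ 1 (Δchanges b s) ≡ occ1-Δchanges-value b s
occ1-Δchanges true [] = refl
occ1-Δchanges false [] = refl
occ1-Δchanges b (c ∷ s') rewrite occ1-Δchanges c s' = byCases b c s'
  where
  byCases : ∀ b c s' → (if Δchanges-head b c s' ≡ᵇ 1 then 1 else 0) + occ1-Δchanges-value c s' ≡ 1
  byCases true true [] = refl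
  byCases true true (true ∷ s) = refl
  byCases true true (false ∷ s) = refl
  byCases true false [] = refl
  byCases true false (true ∷ s) = refl
  byCases true false (false ∷ s) = refl
  byCases false true [] = refl
  byCases false true (true ∷ s) = refl
  byCases false true (false ∷ s) = refl
  byCases false false [] = refl
  byCases false false (true ∷ s) = refl
  byCases false false (false ∷ s) = refl

Δchanges≤2 : ∀ b s → All (_≤ 2) (Δchanges b s)
Δchanges≤2 true [] = z≤n ∷ []
Δchanges≤2 false [] = s≤s z≤n ∷ []
Δchanges≤2 b (c ∷ s') = byCases b c s' ∷ Δchanges≤2 c s'
  where
  byCases : ∀ b c s' → Δchanges-head b c s' ≤ 2
  byCases true true [] = s≤s z≤n
  byCases true true (true ∷ s) = s≤s (s≤s z≤n)
  byCases true true (false ∷ s) = z≤n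
  byCases true false [] = z≤n
  byCases true false (true ∷ s) = z≤n
  byCases true false (false ∷ s) = z≤n
  byCases false true [] = s≤s z≤n
  byCases false true (true ∷ s) = s≤s (s≤s z≤n)
  byCases false true (false ∷ s) = z≤n
  byCases false false [] = s≤s (s≤s z≤n)
  byCases false false (true ∷ s) = s≤s (s≤s z≤n)
  byCases false false (false ∷ s) = s≤s (s≤s z≤n)

length-Δchanges : ∀ b s → length (Δchanges b s) ≡ suc (length s)
length-Δchanges b [] = refl
length-Δchanges b (c ∷ s') = cong suc (length-Δchanges c s')

-- The increments for insertions into a word with signature s at all
-- positions after its first letter, without a preceding letter.
Δpeaks₀-head : Bool → List Bool → ℕ
Δpeaks₀-head c s' = if c ∧ nextDown s' then 0 else 1

Δpeaks₀ : List Bool → List ℕ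
Δpeaks₀ [] = 0 ∷ []
Δpeaks₀ (c ∷ s') = Δpeaks₀-head c s' ∷ Δpeaks c s'

Δpeaks₀-head-correct : ∀ c s' X → 1 + (peakAt false s' + X) ≡ (peakAt c s' + X) + Δpeaks₀-head c s'
Δpeaks₀-head-correct true [] X = +-comm 1 X
Δpeaks₀-head-correct true (true ∷ s) X = +-comm 1 X
Δpeaks₀-head-correct true (false ∷ s) X = sym (+-identityʳ (suc X))
Δpeaks₀-head-correct false s' X = +-comm 1 X

Δpeaks₀-correct : ∀ s → map peaksˢ (insertedSigs s) ≡ map (peaksˢ s +_) (Δpeaks₀ s)
Δpeaks₀-correct [] = refl
Δpeaks₀-correct (c ∷ s') = cong₂ _∷_ (Δpeaks₀-head-correct c s' (peaksˢ s')) (trans (sym (map-∘ (insertedSigs s'))) (Δpeaks-correct c s'))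

occ0-Δpeaks₀ : ∀ s → occ 0 (Δpeaks₀ s) ≡ 1 + 2 * peaksˢ s
occ0-Δpeaks₀ [] = refl
occ0-Δpeaks₀ (c ∷ s') rewrite occ0-Δpeaks c s' = byCases c s'
  where
  arith : ∀ Q X → Q + (1 + (Q + X) + X) ≡ 1 + 2 * (Q + X)
  arith = solve-∀
  byCases : ∀ c s' → (if Δpeaks₀-head c s' ≡ᵇ 0 then 1 else 0) + (1 + peaksˢ (c ∷ s') + peaksˢ s') ≡ 1 + 2 * peaksˢ (c ∷ s')
  byCases true [] = refl
  byCases true (true ∷ s) = arith 0 (peaksˢ (true ∷ s))
  byCases true (false ∷ s) = arith 1 (peaksˢ (false ∷ s))
  byCases false s' = arith 0 (peaksˢ s')

Δpeaks₀≤1 : ∀ s → All (_≤ 1) (Δpeaks₀ s)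
Δpeaks₀≤1 [] = z≤n ∷ []
Δpeaks₀≤1 (c ∷ s') = byCases (c ∧ nextDown s') ∷ Δpeaks≤1 c s'
  where
  byCases : ∀ g → (if g then 0 else 1) ≤ 1
  byCases true = z≤n
  byCases false = s≤s z≤n

length-Δpeaks₀ : ∀ s → length (Δpeaks₀ s) ≡ suc (length s)
length-Δpeaks₀ [] = refl
length-Δpeaks₀ (c ∷ s') = cong suc (length-Δpeaks c s')

Δchanges₀-head : Bool → List Bool → ℕ
Δchanges₀-head c s' = (1 + changeAt false s') ∸ changeAt c s'

Δchanges₀ : List Bool → List ℕ
Δchanges₀ [] = 0 ∷ []
Δchanges₀ (c ∷ s') = Δchanges₀-head c s' ∷ Δchanges c s'

Δchanges₀-head-correct : ∀ c s' X → 1 + (changeAt false s' + X) ≡ (changeAt c s' + X) + Δchanges₀-head c s'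
Δchanges₀-head-correct true [] X = rearrange 1 0 1 X refl
Δchanges₀-head-correct true (true ∷ s) X = rearrange 2 0 2 X refl
Δchanges₀-head-correct true (false ∷ s) X = rearrange 1 1 0 X refl
Δchanges₀-head-correct false [] X = rearrange 1 0 1 X refl
Δchanges₀-head-correct false (true ∷ s) X = rearrange 2 1 1 X refl
Δchanges₀-head-correct false (false ∷ s) X = rearrange 1 0 1 X refl

Δchanges₀-correct : ∀ s → map changesˢ (insertedSigs s) ≡ map (changesˢ s +_) (Δchanges₀ s)
Δchanges₀-correct [] = refl
Δchanges₀-correct (c ∷ s') = cong₂ _∷_ (Δchanges₀-head-correct c s' (changesˢ s')) (trans (sym (map-∘ (insertedSigs s'))) (Δchanges-correct c s'))

occ0-Δchanges₀ : ∀ c s' → occ 0 (Δchanges₀ (c ∷ s')) ≡ 2 * peaksˢ (c ∷ s') + endsUp (c ∷ s')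
occ0-Δchanges₀ c s' rewrite occ0-Δchanges c s' = byCases c s'
  where
  arith : ∀ Q X Lt → Q + (Q + X + X + Lt) ≡ 2 * (Q + X) + Lt
  arith = solve-∀
  byCases : ∀ c s' → (if Δchanges₀-head c s' ≡ᵇ 0 then 1 else 0) + (peaksˢ (c ∷ s') + peaksˢ s' + endsUp (c ∷ s')) ≡ 2 * peaksˢ (c ∷ s') + endsUp (c ∷ s')
  byCases true [] = refl
  byCases true (true ∷ s) = arith 0 (peaksˢ (true ∷ s)) (endsUp (true ∷ true ∷ s))
  byCases true (false ∷ s) = arith 1 (peaksˢ (false ∷ s)) (endsUp (true ∷ false ∷ s))
  byCases false [] = refl
  byCases false (true ∷ s) = arith 0 (peaksˢ (true ∷ s)) (endsUp (false ∷ true ∷ s))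
  byCases false (false ∷ s) = arith 0 (peaksˢ (false ∷ s)) (endsUp (false ∷ false ∷ s))

Δchanges₀≤2 : ∀ s → All (_≤ 2) (Δchanges₀ s)
Δchanges₀≤2 [] = z≤n ∷ []
Δchanges₀≤2 (c ∷ s') = byCases c s' ∷ Δchanges≤2 c s'
  where
  byCases : ∀ c s' → Δchanges₀-head c s' ≤ 2
  byCases true [] = s≤s z≤n
  byCases true (true ∷ s) = s≤s (s≤s z≤n)
  byCases true (false ∷ s) = z≤n
  byCases false [] = s≤s z≤n
  byCases false (true ∷ s) = s≤s z≤n
  byCases false (false ∷ s) = s≤s z≤n

occ1-Δchanges₀-up : ∀ s → occ 1 (Δchanges₀ (true ∷ s)) ≡ 1
occ1-Δchanges₀-up s rewrite occ1-Δchanges true s = byCases s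
  where
  byCases : ∀ s → (if Δchanges₀-head true s ≡ᵇ 1 then 1 else 0) + occ1-Δchanges-value true s ≡ 1
  byCases [] = refl
  byCases (true ∷ s) = refl
  byCases (false ∷ s) = refl

-- Including the front insertion (increment [first step is an ascent]),
-- exactly two insertions create one new direction change.
occ1-runs-increments : ∀ c s' → occ 1 (b2n c ∷ Δchanges₀ (c ∷ s')) ≡ 2
occ1-runs-increments c s' rewrite occ1-Δchanges c s' = byCases c s'
  where
  byCases : ∀ c s' → (if b2n c ≡ᵇ 1 then 1 else 0) + ((if Δchanges₀-head c s' ≡ᵇ 1 then 1 else 0) + occ1-Δchanges-value c s') ≡ 2
  byCases true [] = refl
  byCases true (true ∷ s) = refl
  byCases true (false ∷ s) = refl
  byCases false [] = refl
  byCases false (true ∷ s) = refl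
  byCases false (false ∷ s) = refl

-- Direction changes are peaks and valleys; valleys and peaks alternate.
changes-vs-peaks : ∀ b r → changesˢ (b ∷ r) + b2n b ≡ 2 * peaksˢ (b ∷ r) + endsUp (b ∷ r)
changes-vs-peaks true [] = refl
changes-vs-peaks false [] = refl
changes-vs-peaks b (c ∷ r) = byCases b c (changes-vs-peaks c r)
  where
  byCases : ∀ b c → changesˢ (c ∷ r) + b2n c ≡ 2 * peaksˢ (c ∷ r) + endsUp (c ∷ r) →
      changeAt b (c ∷ r) + changesˢ (c ∷ r) + b2n b ≡ 2 * (peakAt b (c ∷ r) + peaksˢ (c ∷ r)) + endsUp (c ∷ r)
  byCases true true ih = ih
  byCases true false ih = trans (arith₁ (changesˢ (false ∷ r))) (trans (cong (2 +_) ih) (arith₂ (peaksˢ (false ∷ r)) (endsUp (false ∷ r))))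
    where
    arith₁ : ∀ X → 1 + X + 1 ≡ 2 + (X + 0)
    arith₁ = solve-∀
    arith₂ : ∀ Y Lt → 2 + (2 * Y + Lt) ≡ 2 * (1 + Y) + Lt
    arith₂ = solve-∀
  byCases false true ih = trans (arith₁ (changesˢ (true ∷ r))) ih
    where
    arith₁ : ∀ X → 1 + X + 0 ≡ X + 1
    arith₁ = solve-∀
  byCases false false ih = ih

occ0-runs-increments : ∀ c s' → occ 0 (b2n c ∷ Δchanges₀ (c ∷ s')) ≡ 1 + changesˢ (c ∷ s')
occ0-runs-increments c s' rewrite occ0-Δchanges₀ c s' = byCases c (changes-vs-peaks c s')
  where
  byCases : ∀ c → changesˢ (c ∷ s') + b2n c ≡ 2 * peaksˢ (c ∷ s') + endsUp (c ∷ s') →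
      (if b2n c ≡ᵇ 0 then 1 else 0) + (2 * peaksˢ (c ∷ s') + endsUp (c ∷ s')) ≡ 1 + changesˢ (c ∷ s')
  byCases true e = trans (sym e) (+-comm _ 1)
  byCases false e = cong suc (trans (sym e) (+-identityʳ _))

occ0-as-increments : ∀ s → occ 0 (Δchanges₀ (true ∷ s)) ≡ 1 + changesˢ (true ∷ s)
occ0-as-increments s = trans (occ0-Δchanges₀ true s) (trans (sym (changes-vs-peaks true s)) (+-comm _ 1))

signature : List ℕ → List Bool
signature (x ∷ y ∷ r) = (x <ᵇ y) ∷ signature (y ∷ r)
signature _           = []

NeighboursDistinct : List ℕ → Set
NeighboursDistinct (x ∷ y ∷ r) = (¬ x ≡ y) × NeighboursDistinct (y ∷ r)
NeighboursDistinct _           = ⊤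

<ᵇ-flip : ∀ y z → ¬ y ≡ z → (z <ᵇ y) ≡ not (y <ᵇ z)
<ᵇ-flip y z y≢z with <-cmp y z
... | tri< y<z _ _ rewrite <ᵇ-true y<z | <ᵇ-false {z} {y} (<⇒≯ y<z) = refl
... | tri≈ _ y≡z _ = ⊥-elim (y≢z y≡z)
... | tri> _ _ z<y rewrite <ᵇ-true z<y | <ᵇ-false {y} {z} (<⇒≯ z<y) = refl

peaks-signature : ∀ w → NeighboursDistinct w → peaks w ≡ peaksˢ (signature w)
peaks-signature []          _ = refl
peaks-signature (x ∷ [])     _ = refl
peaks-signature (x ∷ y ∷ []) _ with x <ᵇ y
... | true  = refl
... | false = refl
peaks-signature (x ∷ y ∷ z ∷ r) (_ , y≢z , distinct) =
  cong₂ _+_ (cong (λ q → b2n ((x <ᵇ y) ∧ q)) (<ᵇ-flip y z y≢z))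
            (peaks-signature (y ∷ z ∷ r) (y≢z , distinct))

changes-signature : ∀ w → NeighboursDistinct w → changes w ≡ changesˢ (signature w)
changes-signature []          _ = refl
changes-signature (x ∷ [])     _ = refl
changes-signature (x ∷ y ∷ []) _ with x <ᵇ y
... | true  = refl
... | false = refl
changes-signature (x ∷ y ∷ z ∷ r) (x≢y , y≢z , distinct) =
  cong₂ _+_ (trans (cong₂ (λ p q → b2n (((x <ᵇ y) ∧ p) ∨ (q ∧ (y <ᵇ z)))) (<ᵇ-flip y z y≢z) (<ᵇ-flip x y x≢y))
                   (byCases (x <ᵇ y) (y <ᵇ z)))
            (changes-signature (y ∷ z ∷ r) (y≢z , distinct))
  where
  byCases : ∀ p q → b2n (p ∧ not q ∨ not p ∧ q) ≡ b2n (if p then not q else q)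
  byCases true  true  = refl
  byCases true  false = refl
  byCases false true  = refl
  byCases false false = refl

insertMax : ℕ → List ℕ → List (List ℕ)
insertMax m []       = (m ∷ []) ∷ []
insertMax m (x ∷ xs) = (m ∷ x ∷ xs) ∷ map (x ∷_) (insertMax m xs)

signature-insertMax-after : ∀ m x τ → x < m → All (_< m) τ →
  map (λ ρ → signature (x ∷ ρ)) (insertMax m τ) ≡ insertedSigs (signature (x ∷ τ))
signature-insertMax-after m x []      x<m []          rewrite <ᵇ-true x<m = refl
signature-insertMax-after m x (y ∷ τ) x<m (y<m ∷ τ<m) rewrite <ᵇ-true x<m | <ᵇ-false {m} {y} (<⇒≯ y<m) =
  cong ((true ∷ false ∷ signature (y ∷ τ)) ∷_) (begin
    map (λ ρ → signature (x ∷ ρ)) (map (y ∷_) (insertMax m τ))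
      ≡⟨ sym (map-∘ (insertMax m τ)) ⟩
    map (λ ρ → (x <ᵇ y) ∷ signature (y ∷ ρ)) (insertMax m τ)
      ≡⟨ map-∘ (insertMax m τ) ⟩
    map ((x <ᵇ y) ∷_) (map (λ ρ → signature (y ∷ ρ)) (insertMax m τ))
      ≡⟨ cong (map ((x <ᵇ y) ∷_)) (signature-insertMax-after m y τ y<m τ<m) ⟩
    map ((x <ᵇ y) ∷_) (insertedSigs (signature (y ∷ τ))) ∎)
  where open ≡-Reasoning

signature-insertMax : ∀ m x τ → All (_< m) (x ∷ τ) →
  map signature (insertMax m (x ∷ τ)) ≡ allInsertedSigs (signature (x ∷ τ))
signature-insertMax m x τ (x<m ∷ τ<m) rewrite <ᵇ-false {m} {x} (<⇒≯ x<m) =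
  cong (_ ∷_) (trans (sym (map-∘ (insertMax m τ))) (signature-insertMax-after m x τ x<m τ<m))

distinct-insertMax-after : ∀ m x τ → x < m → All (_< m) τ → NeighboursDistinct (x ∷ τ) →
                           All (λ ρ → NeighboursDistinct (x ∷ ρ)) (insertMax m τ)
distinct-insertMax-after m x []      x<m []          _ = (<⇒≢ x<m , tt) ∷ []
distinct-insertMax-after m x (y ∷ τ) x<m (y<m ∷ τ<m) (x≢y , distinct) =
  (<⇒≢ x<m , (λ m≡y → <⇒≢ y<m (sym m≡y)) , distinct)
  ∷ AllP.map⁺ (All.map (x≢y ,_) (distinct-insertMax-after m y τ y<m τ<m distinct))

distinct-insertMax : ∀ m τ → All (_< m) τ → NeighboursDistinct τ → All NeighboursDistinct (insertMax m τ)
distinct-insertMax m []      []          _        = tt ∷ []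
distinct-insertMax m (x ∷ τ) (x<m ∷ τ<m) distinct =
  ((λ m≡x → <⇒≢ x<m (sym m≡x)) , distinct) ∷ AllP.map⁺ (distinct-insertMax-after m x τ x<m τ<m distinct)

ipk-insertMax : ∀ m x τ → All (_< m) (x ∷ τ) → NeighboursDistinct (x ∷ τ) →
  map ipk (insertMax m (x ∷ τ)) ≡ map (peaksˢ (signature (x ∷ τ)) +_) (0 ∷ Δpeaks₀ (signature (x ∷ τ)))
ipk-insertMax m x τ <m distinct = begin
  map peaks (insertMax m (x ∷ τ))
    ≡⟨ map-cong-local (All.map (λ {ρ} → peaks-signature ρ) (distinct-insertMax m (x ∷ τ) <m distinct)) ⟩
  map (peaksˢ ∘ signature) (insertMax m (x ∷ τ))
    ≡⟨ map-∘ (insertMax m (x ∷ τ)) ⟩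
  map peaksˢ (map signature (insertMax m (x ∷ τ)))
    ≡⟨ cong (map peaksˢ) (signature-insertMax m x τ <m) ⟩
  map peaksˢ (allInsertedSigs (signature (x ∷ τ)))
    ≡⟨ cong₂ _∷_ (sym (+-identityʳ _)) (Δpeaks₀-correct (signature (x ∷ τ))) ⟩
  map (peaksˢ (signature (x ∷ τ)) +_) (0 ∷ Δpeaks₀ (signature (x ∷ τ))) ∎
  where open ≡-Reasoning

lpk-insertMax : ∀ m σ → 0 < m → All (_< m) σ → NeighboursDistinct (0 ∷ σ) →
  map lpk (insertMax m σ) ≡ map (peaksˢ (signature (0 ∷ σ)) +_) (Δpeaks₀ (signature (0 ∷ σ)))
lpk-insertMax m σ 0<m <m distinct = begin
  map (λ ρ → peaks (0 ∷ ρ)) (insertMax m σ)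
    ≡⟨ map-cong-local (All.map (λ {ρ} → peaks-signature (0 ∷ ρ))
                               (distinct-insertMax-after m 0 σ 0<m <m distinct)) ⟩
  map (λ ρ → peaksˢ (signature (0 ∷ ρ))) (insertMax m σ)
    ≡⟨ map-∘ (insertMax m σ) ⟩
  map peaksˢ (map (λ ρ → signature (0 ∷ ρ)) (insertMax m σ))
    ≡⟨ cong (map peaksˢ) (signature-insertMax-after m 0 σ 0<m <m) ⟩
  map peaksˢ (insertedSigs (signature (0 ∷ σ)))
    ≡⟨ Δpeaks₀-correct (signature (0 ∷ σ)) ⟩
  map (peaksˢ (signature (0 ∷ σ)) +_) (Δpeaks₀ (signature (0 ∷ σ))) ∎
  where open ≡-Reasoning

runs-insertMax : ∀ m x y τ → All (_< m) (x ∷ y ∷ τ) → NeighboursDistinct (x ∷ y ∷ τ) →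
  map runs (insertMax m (x ∷ y ∷ τ))
    ≡ map (suc (changesˢ (signature (x ∷ y ∷ τ))) +_) (b2n (x <ᵇ y) ∷ Δchanges₀ (signature (x ∷ y ∷ τ)))
runs-insertMax m x y τ <m distinct = begin
  map runs ρs
    ≡⟨ map-cong-local (All.map (λ {ρ} d → cong suc (changes-signature ρ d)) (distinct-insertMax m (x ∷ y ∷ τ) <m distinct)) ⟩
  map (suc ∘ changesˢ ∘ signature) ρs
    ≡⟨ map-∘ ρs ⟩
  map (suc ∘ changesˢ) (map signature ρs)
    ≡⟨ cong (map (suc ∘ changesˢ)) (signature-insertMax m x (y ∷ τ) <m) ⟩
  map (suc ∘ changesˢ) (allInsertedSigs s)
    ≡⟨ map-∘ (allInsertedSigs s) ⟩
  map suc (map changesˢ (allInsertedSigs s))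
    ≡⟨ cong (map suc) (cong₂ _∷_ (+-comm (b2n (x <ᵇ y)) (changesˢ s)) (Δchanges₀-correct s)) ⟩
  map suc (map (changesˢ s +_) (b2n (x <ᵇ y) ∷ Δchanges₀ s))
    ≡⟨ sym (map-∘ (b2n (x <ᵇ y) ∷ Δchanges₀ s)) ⟩
  map (suc (changesˢ s) +_) (b2n (x <ᵇ y) ∷ Δchanges₀ s) ∎
  where
  open ≡-Reasoning
  ρs = insertMax m (x ∷ y ∷ τ)
  s  = signature (x ∷ y ∷ τ)

-- The maximal length of an alternating subsequence s₁ > s₂ < s₃ > ⋯
-- (downLength) or s₁ < s₂ > s₃ < ⋯ (upLength) of a word with distinct
-- neighbours, computed greedily from the left; alt-bounded and
-- alt-witnesses below show that the greedy values are the maxima.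
downLength upLength : List ℕ → ℕ
downLength [] = 0
downLength (x ∷ []) = 1
downLength (x ∷ y ∷ r) = if x <ᵇ y then downLength (y ∷ r) else suc (upLength (y ∷ r))
upLength [] = 0
upLength (x ∷ []) = 1
upLength (x ∷ y ∷ r) = if x <ᵇ y then suc (downLength (y ∷ r)) else upLength (y ∷ r)

downLengthˢ upLengthˢ : List Bool → ℕ
downLengthˢ [] = 1
downLengthˢ (b ∷ s) = if b then downLengthˢ s else suc (upLengthˢ s)
upLengthˢ [] = 1
upLengthˢ (b ∷ s) = if b then suc (downLengthˢ s) else upLengthˢ s

downLength-signature : ∀ x w → downLength (x ∷ w) ≡ downLengthˢ (signature (x ∷ w)) × upLength (x ∷ w) ≡ upLengthˢ (signature (x ∷ w))
downLength-signature x [] = refl , refl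
downLength-signature x (y ∷ w) with x <ᵇ y | downLength-signature y w
... | true | e1 , e2 = e1 , cong suc e1
... | false | e1 , e2 = cong suc e2 , e2

-- Greedy alternating subsequences turn at every direction change.
downLengthˢ-changes : ∀ s → downLengthˢ s ≡ suc (changesˢ (true ∷ s)) × upLengthˢ s ≡ suc (changesˢ (false ∷ s))
downLengthˢ-changes [] = refl , refl
downLengthˢ-changes (true ∷ s) with downLengthˢ-changes s
... | e1 , e2 = e1 , cong suc e1
downLengthˢ-changes (false ∷ s) with downLengthˢ-changes s
... | e1 , e2 = cong suc e2 , e2

-- Dropping the first element of an alternating subsequence changes its type.
down-up-bound : ∀ w → downLength w ≤ suc (upLength w) × upLength w ≤ suc (downLength w)
down-up-bound [] = z≤n , z≤n
down-up-bound (x ∷ []) = n≤1+n 1 , n≤1+n 1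
down-up-bound (x ∷ y ∷ r) with x <ᵇ y
... | true = ≤-trans (n≤1+n _) (n≤1+n _) , ≤-refl
... | false = ≤-refl , ≤-trans (n≤1+n _) (n≤1+n _)

down-up-positive : ∀ x w → 1 ≤ downLength (x ∷ w) × 1 ≤ upLength (x ∷ w)
down-up-positive x [] = ≤-refl , ≤-refl
down-up-positive x (y ∷ w) with x <ᵇ y
... | true = proj₁ (down-up-positive y w) , s≤s z≤n
... | false = s≤s z≤n , proj₂ (down-up-positive y w)

down-up-mono : ∀ x y w → downLength (y ∷ w) ≤ downLength (x ∷ y ∷ w) × upLength (y ∷ w) ≤ upLength (x ∷ y ∷ w)
down-up-mono x y w with x <ᵇ y
... | true = ≤-refl , ≤-trans (proj₂ (down-up-bound (y ∷ w))) ≤-refl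
... | false = proj₁ (down-up-bound (y ∷ w)) , ≤-refl

subseq-split : ∀ x w s → s ∈ subseqs (x ∷ w) → (Σ[ s' ∈ List ℕ ] (s ≡ x ∷ s' × s' ∈ subseqs w)) ⊎ s ∈ subseqs w
subseq-split x w s m with ∈-++⁻ (map (x ∷_) (subseqs w)) m
... | inj₁ mm with ∈-map⁻ (x ∷_) mm
...   | s' , m' , e = inj₁ (s' , e , m')
subseq-split x w s m | inj₂ mm = inj₂ mm

subseq-cons : ∀ x w s' → s' ∈ subseqs w → x ∷ s' ∈ subseqs (x ∷ w)
subseq-cons x w s' m = ∈-++⁺ˡ (∈-map⁺ (x ∷_) m)

subseq-skip : ∀ x w s → s ∈ subseqs w → s ∈ subseqs (x ∷ w)
subseq-skip x w s m = ∈-++⁺ʳ (map (x ∷_) (subseqs w)) m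

AltBounded : List ℕ → List ℕ → Set
AltBounded w s = (altDown s ≡ true → length s ≤ downLength w) × (altUp s ≡ true → length s ≤ upLength w)

-- Prepending x to y ∷ w: a subsequence either skips x (and the greedy
-- lengths only grow), or is x followed by a subsequence z ∷ zs of y ∷ w;
-- if z is on the wrong side of y relative to x we may replace x by y.
alt-bounded-step : ∀ x y w → ¬ x ≡ y → (∀ s → s ∈ subseqs (y ∷ w) → AltBounded (y ∷ w) s) →
                   ∀ s → s ∈ subseqs (x ∷ y ∷ w) → AltBounded (x ∷ y ∷ w) s
alt-bounded-step x y w x≢y IH s s∈ with subseq-split x (y ∷ w) s s∈
... | inj₂ s∈' = let (down , up) = IH s s∈' ; (down≤ , up≤) = down-up-mono x y w in
                 (λ alt → ≤-trans (down alt) down≤) , (λ alt → ≤-trans (up alt) up≤)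
... | inj₁ ([] , refl , _) = (λ _ → proj₁ (down-up-positive x (y ∷ w))) , (λ _ → proj₂ (down-up-positive x (y ∷ w)))
... | inj₁ ((z ∷ zs) , refl , z∷zs∈) = down , up
  where
  replaceByY : z ∷ zs ∈ subseqs (y ∷ w) → ¬ z ≡ y → y ∷ z ∷ zs ∈ subseqs (y ∷ w)
  replaceByY z∷zs∈ z≢y with subseq-split y w _ z∷zs∈
  ... | inj₁ (_ , refl , _) = ⊥-elim (z≢y refl)
  ... | inj₂ z∷zs∈w = subseq-cons y w _ z∷zs∈w
  y<x : (x <ᵇ y) ≡ false → y < x
  y<x x≮y = ≤∧≢⇒< (≮⇒≥ (λ x<y → true≢false (<ᵇ-true x<y) x≮y)) (λ y≡x → x≢y (sym y≡x))
  down : altDown (x ∷ z ∷ zs) ≡ true → length (x ∷ z ∷ zs) ≤ downLength (x ∷ y ∷ w)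
  down alt with ∧-true {z <ᵇ x} alt | x <ᵇ y in x<ᵇy
  ... | (z<ᵇx , alt') | true =
    let z<y = <-trans (<ᵇ⇒< z x (subst T (sym z<ᵇx) tt)) (<ᵇ⇒< x y (subst T (sym x<ᵇy) tt))
    in proj₁ (IH (y ∷ z ∷ zs) (replaceByY z∷zs∈ (λ z≡y → <-irrefl z≡y z<y))) (cong₂ _∧_ (<ᵇ-true z<y) alt')
  ... | (_ , alt') | false = s≤s (proj₂ (IH (z ∷ zs) z∷zs∈) alt')
  up : altUp (x ∷ z ∷ zs) ≡ true → length (x ∷ z ∷ zs) ≤ upLength (x ∷ y ∷ w)
  up alt with ∧-true {x <ᵇ z} alt | x <ᵇ y in x<ᵇy
  ... | (_ , alt') | true = s≤s (proj₁ (IH (z ∷ zs) z∷zs∈) alt')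
  ... | (x<ᵇz , alt') | false =
    let y<z = <-trans (y<x x<ᵇy) (<ᵇ⇒< x z (subst T (sym x<ᵇz) tt))
    in proj₂ (IH (y ∷ z ∷ zs) (replaceByY z∷zs∈ (λ z≡y → <-irrefl (sym z≡y) y<z))) (cong₂ _∧_ (<ᵇ-true y<z) alt')

alt-bounded : ∀ w → NeighboursDistinct w → ∀ s → s ∈ subseqs w → AltBounded w s
alt-bounded []       _ .[] (here refl) = (λ _ → z≤n) , (λ _ → z≤n)
alt-bounded (x ∷ []) _ s   s∈ with subseq-split x [] s s∈
... | inj₁ (.[] , refl , here refl) = (λ _ → ≤-refl) , (λ _ → ≤-refl)
... | inj₂ (here refl)              = (λ _ → z≤n) , (λ _ → z≤n)
alt-bounded (x ∷ y ∷ w) (x≢y , distinct) =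
  alt-bounded-step x y w x≢y (alt-bounded (y ∷ w) distinct)

AltWitnesses : ℕ → List ℕ → Set
AltWitnesses y w = (Σ[ h ∈ ℕ ] Σ[ t ∈ List ℕ ] ((h ∷ t) ∈ subseqs (y ∷ w) × altDown (h ∷ t) ≡ true × suc (length t) ≡ downLength (y ∷ w) × y ≤ h))
         × (Σ[ h ∈ ℕ ] Σ[ t ∈ List ℕ ] ((h ∷ t) ∈ subseqs (y ∷ w) × altUp (h ∷ t) ≡ true × suc (length t) ≡ upLength (y ∷ w) × h ≤ y))

-- If x < y, the best down-subsequence of y ∷ w serves for x ∷ y ∷ w too,
-- and prefixing x to it gives an up-subsequence; symmetrically if y < x.
alt-witnesses : ∀ y w → NeighboursDistinct (y ∷ w) → AltWitnesses y w
alt-witnesses y [] _ = (y , [] , here refl , refl , refl , ≤-refl) , (y , [] , here refl , refl , refl , ≤-refl)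
alt-witnesses x (y ∷ w) (x≢y , neighbours) with alt-witnesses y w neighbours | x <ᵇ y in x<ᵇy
... | (hD , tD , ∈D , altD , lenD , y≤hD) , _ | true =
  (hD , tD , subseq-skip x (y ∷ w) _ ∈D , altD , lenD , ≤-trans (<⇒≤ x<y) y≤hD) ,
  (x , hD ∷ tD , subseq-cons x (y ∷ w) _ ∈D , cong₂ _∧_ (<ᵇ-true (<-≤-trans x<y y≤hD)) altD , cong suc lenD , ≤-refl)
  where
  x<y = <ᵇ⇒< x y (subst T (sym x<ᵇy) tt)
... | _ , (hU , tU , ∈U , altU , lenU , hU≤y) | false =
  (x , hU ∷ tU , subseq-cons x (y ∷ w) _ ∈U , cong₂ _∧_ (<ᵇ-true (≤-<-trans hU≤y y<x)) altU , cong suc lenU , ≤-refl) ,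
  (hU , tU , subseq-skip x (y ∷ w) _ ∈U , altU , lenU , ≤-trans hU≤y (<⇒≤ y<x))
  where
  y<x : y < x
  y<x = ≤∧≢⇒< (≮⇒≥ (λ x<y → true≢false (<ᵇ-true x<y) x<ᵇy)) (λ y≡x → x≢y (sym y≡x))

maxList-lub : ∀ l v → All (_≤ v) l → maxList l ≤ v
maxList-lub [] v [] = z≤n
maxList-lub (a ∷ l) v (p ∷ ps) = ⊔-lub p (maxList-lub l v ps)

maxList-upper : ∀ l v → v ∈ l → v ≤ maxList l
maxList-upper (a ∷ l) v (here refl) = m≤m⊔n a (maxList l)
maxList-upper (a ∷ l) v (there m) = m≤n⇒m≤o⊔n a (maxList-upper l v m)

altLength : List ℕ → ℕ
altLength s = if altDown s then length s else 0

as-downLength : ∀ x w → NeighboursDistinct (x ∷ w) → as (x ∷ w) ≡ downLength (x ∷ w)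
as-downLength x w distinct with alt-witnesses x w distinct
... | (h , t , h∷t∈ , alt , len , _) , _ =
  ≤-antisym (maxList-lub _ _ (AllP.map⁺ (All.tabulate (λ {s} s∈ → bounded s (alt-bounded (x ∷ w) distinct s s∈)))))
            (maxList-upper _ _ (subst (_∈ map altLength (subseqs (x ∷ w))) attained (∈-map⁺ altLength h∷t∈)))
  where
  bounded : ∀ s → AltBounded (x ∷ w) s → altLength s ≤ downLength (x ∷ w)
  bounded s (down , _) with altDown s
  ... | true  = down refl
  ... | false = z≤n
  attained : altLength (h ∷ t) ≡ downLength (x ∷ w)
  attained rewrite alt = len

-- For a word x ∷ w of positive letters, as(x ∷ w) is one more than the
-- number of direction changes of 0 ∷ x ∷ w: this is what makes `as`
-- behave like a run statistic under insertions.
as-changes : ∀ x w → NeighboursDistinct (0 ∷ x ∷ w) → as (x ∷ w) ≡ suc (changesˢ (signature (0 ∷ x ∷ w)))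
as-changes zero w (ne , _) = ⊥-elim (ne refl)
as-changes (suc x) w (_ , distinct) = begin
  as (suc x ∷ w)                        ≡⟨ as-downLength (suc x) w distinct ⟩
  downLength (suc x ∷ w)                ≡⟨ proj₁ (downLength-signature (suc x) w) ⟩
  downLengthˢ (signature (suc x ∷ w))   ≡⟨ proj₁ (downLengthˢ-changes (signature (suc x ∷ w))) ⟩
  suc (changesˢ (true ∷ signature (suc x ∷ w))) ∎
  where open ≡-Reasoning

range : ℕ → List ℕ
range n = map suc (upTo n)

range⁻ : ∀ {n x} → x ∈ range n → 1 ≤ x × x ≤ n
range⁻ {n} x∈ with ∈-map⁻ suc x∈
... | i , i∈ , refl = s≤s z≤n , ∈-upTo⁻ i∈

range⁺ : ∀ {n x} → 1 ≤ x → x ≤ n → x ∈ range n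
range⁺ {n} {suc x} _ x≤n = ∈-map⁺ suc (∈-upTo⁺ x≤n)

unique-range : ∀ n → Unique (range n)
unique-range n = UniqueP.map⁺ suc-injective (UniqueP.upTo⁺ n)

length-range : ∀ N → length (range N) ≡ N
length-range N = trans (length-map suc (upTo N)) (length-upTo N)

range-suc : ∀ {N y} → y ∈ range N → y ∈ range (suc N)
range-suc y∈ = let (1≤y , y≤N) = range⁻ y∈ in range⁺ 1≤y (≤-trans y≤N (n≤1+n _))

range-pred : ∀ {N y} → y ∈ range (suc N) → ¬ suc N ≡ y → y ∈ range N
range-pred y∈ y≢ = let (1≤y , y≤) = range⁻ y∈ in range⁺ 1≤y (≤-pred (≤∧≢⇒< y≤ (λ y≡ → y≢ (sym y≡))))

range-new : ∀ {N y} → y ∈ range N → ¬ suc N ≡ y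
range-new y∈ e = let (_ , y≤N) = range⁻ y∈ in <-irrefl (sym e) (s≤s y≤N)

concatMap⁻ : ∀ {A B : Set} (f : A → List B) xs {y} → y ∈ concatMap f xs → ∃ λ x → x ∈ xs × y ∈ f x
concatMap⁻ f xs y∈ =
  let (ys , y∈ys , ys∈) = ∈-concat⁻′ (map f xs) y∈ ; (x , x∈ , ys≡) = ∈-map⁻ f ys∈
  in x , x∈ , subst (_ ∈_) ys≡ y∈ys

concatMap⁺ : ∀ {A B : Set} (f : A → List B) {xs x y} → x ∈ xs → y ∈ f x → y ∈ concatMap f xs
concatMap⁺ f x∈ y∈ = ∈-concat⁺′ y∈ (∈-map⁺ f x∈)

unique-concatMap : ∀ {A B : Set} (f : A → List B) xs → Unique xs → (∀ {x} → x ∈ xs → Unique (f x)) →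
                   (∀ {x y b} → x ∈ xs → y ∈ xs → b ∈ f x → b ∈ f y → x ≡ y) → Unique (concatMap f xs)
unique-concatMap f []       _              _        _        = []
unique-concatMap f (x ∷ xs) (x∉xs ∷ uxs) unique-f disjoint =
  UniqueP.++⁺ (unique-f (here refl))
              (unique-concatMap f xs uxs (unique-f ∘ there) (λ x∈ y∈ → disjoint (there x∈) (there y∈)))
              λ (b∈fx , b∈rest) → let (y , y∈ , b∈fy) = concatMap⁻ f xs b∈rest
                                  in All.lookup x∉xs y∈ (disjoint (here refl) (there y∈) b∈fx b∈fy)

words⁻ : ∀ n k w → w ∈ words n k → length w ≡ k × All (_∈ range n) w
words⁻ n zero    .[] (here refl) = refl , []
words⁻ n (suc k) w   w∈ with concatMap⁻ (λ x → map (x ∷_) (words n k)) (range n) w∈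
... | x , x∈ , w∈' with ∈-map⁻ (x ∷_) w∈'
...   | w' , w'∈ , refl = let (len , letters) = words⁻ n k w' w'∈ in cong suc len , x∈ ∷ letters

words⁺ : ∀ n w → All (_∈ range n) w → w ∈ words n (length w)
words⁺ n []      []              = here refl
words⁺ n (x ∷ w) (x∈ ∷ letters) =
  concatMap⁺ (λ x → map (x ∷_) (words n (length w))) x∈ (∈-map⁺ (x ∷_) (words⁺ n w letters))

unique-words : ∀ n k → Unique (words n k)
unique-words n zero    = [] ∷ []
unique-words n (suc k) =
  unique-concatMap _ (range n) (unique-range n) (λ _ → UniqueP.map⁺ ∷-injectiveʳ (unique-words n k)) (λ _ _ → sameHead)
  where
  sameHead : ∀ {x y b} → b ∈ map (x ∷_) (words n k) → b ∈ map (y ∷_) (words n k) → x ≡ y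
  sameHead b∈ b∈' with ∈-map⁻ _ b∈ | ∈-map⁻ _ b∈'
  ... | _ , _ , refl | _ , _ , refl = refl

notIn⁻ : ∀ x w → notIn x w ≡ true → All (λ y → ¬ x ≡ y) w
notIn⁻ x []      _ = []
notIn⁻ x (y ∷ w) e with x ≡ᵇ y in x≡ᵇy
... | false = (λ x≡y → subst T x≡ᵇy (≡⇒≡ᵇ x y x≡y)) ∷ notIn⁻ x w e

notIn⁺ : ∀ x w → All (λ y → ¬ x ≡ y) w → notIn x w ≡ true
notIn⁺ x []      []             = refl
notIn⁺ x (y ∷ w) (x≢y ∷ x∉w) with x ≡ᵇ y in x≡ᵇy
... | true  = ⊥-elim (x≢y (≡ᵇ⇒≡ x y (subst T (sym x≡ᵇy) tt)))
... | false = notIn⁺ x w x∉w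

distinct⁻ : ∀ w → distinct w ≡ true → Unique w
distinct⁻ []      _ = []
distinct⁻ (x ∷ w) e = let (e₁ , e₂) = ∧-true {notIn x w} e in notIn⁻ x w e₁ ∷ distinct⁻ w e₂

distinct⁺ : ∀ w → Unique w → distinct w ≡ true
distinct⁺ []      _            = refl
distinct⁺ (x ∷ w) (x∉w ∷ uw) rewrite notIn⁺ x w x∉w = distinct⁺ w uw

IsPerm : ℕ → List ℕ → Set
IsPerm n w = length w ≡ n × All (_∈ range n) w × Unique w

dec-true : ∀ (b : Bool) → Dec (b ≡ true)
dec-true b = Bool._≟_ b true

Sym⁻ : ∀ n w → w ∈ Sym n → IsPerm n w
Sym⁻ n w w∈ with ∈-filter⁻ (λ w → dec-true (distinct w)) {xs = words n n} w∈
... | w∈words , dist = let (len , letters) = words⁻ n n w w∈words in len , letters , distinct⁻ w dist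

Sym⁺ : ∀ n w → IsPerm n w → w ∈ Sym n
Sym⁺ n w (refl , letters , uw) = ∈-filter⁺ (λ w → dec-true (distinct w)) (words⁺ n w letters) (distinct⁺ w uw)

unique-Sym : ∀ n → Unique (Sym n)
unique-Sym n = UniqueP.filter⁺ (λ w → dec-true (distinct w)) (unique-words n n)

module _ (m : ℕ) where

  length-insertMax : ∀ σ {ρ} → ρ ∈ insertMax m σ → length ρ ≡ suc (length σ)
  length-insertMax []      (here refl) = refl
  length-insertMax (x ∷ σ) (here refl) = refl
  length-insertMax (x ∷ σ) (there ρ∈) with ∈-map⁻ (x ∷_) ρ∈
  ... | _ , ρ'∈ , refl = cong suc (length-insertMax σ ρ'∈)

  All-insertMax : ∀ {P : ℕ → Set} σ {ρ} → P m → All P σ → ρ ∈ insertMax m σ → All P ρ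
  All-insertMax []      Pm []         (here refl) = Pm ∷ []
  All-insertMax (x ∷ σ) Pm (Px ∷ Pσ) (here refl) = Pm ∷ Px ∷ Pσ
  All-insertMax (x ∷ σ) Pm (Px ∷ Pσ) (there ρ∈) with ∈-map⁻ (x ∷_) ρ∈
  ... | _ , ρ'∈ , refl = Px ∷ All-insertMax σ Pm Pσ ρ'∈

  unique-insertMax-elem : ∀ σ {ρ} → All (λ y → ¬ m ≡ y) σ → Unique σ → ρ ∈ insertMax m σ → Unique ρ
  unique-insertMax-elem []      _              _             (here refl) = [] ∷ []
  unique-insertMax-elem (x ∷ σ) m∉σ           uσ            (here refl) = m∉σ ∷ uσ
  unique-insertMax-elem (x ∷ σ) (m≢x ∷ m∉σ) (x∉σ ∷ uσ) (there ρ∈) with ∈-map⁻ (x ∷_) ρ∈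
  ... | _ , ρ'∈ , refl = All-insertMax {λ y → ¬ x ≡ y} σ (λ x≡m → m≢x (sym x≡m)) x∉σ ρ'∈ ∷ unique-insertMax-elem σ m∉σ uσ ρ'∈

  -- Deleting m inverts the insertions, so different σ give different words.
  deleteMax : List ℕ → List ℕ
  deleteMax []       = []
  deleteMax (x ∷ xs) = if x ≡ᵇ m then xs else x ∷ deleteMax xs

  deleteMax-insertMax : ∀ σ {ρ} → All (λ y → ¬ m ≡ y) σ → ρ ∈ insertMax m σ → deleteMax ρ ≡ σ
  deleteMax-insertMax []      _              (here refl) rewrite ≡ᵇ-true {m} refl = refl
  deleteMax-insertMax (x ∷ σ) _              (here refl) rewrite ≡ᵇ-true {m} refl = refl
  deleteMax-insertMax (x ∷ σ) (m≢x ∷ m∉σ) (there ρ∈) with ∈-map⁻ (x ∷_) ρ∈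
  ... | _ , ρ'∈ , refl rewrite ≡ᵇ-false {x} {m} (λ x≡m → m≢x (sym x≡m)) = cong (x ∷_) (deleteMax-insertMax σ m∉σ ρ'∈)

  insertMax-complete : ∀ α β → α ++ m ∷ β ∈ insertMax m (α ++ β)
  insertMax-complete []      []      = here refl
  insertMax-complete []      (y ∷ β) = here refl
  insertMax-complete (x ∷ α) β       = there (∈-map⁺ (x ∷_) (insertMax-complete α β))

  unique-insertMax : ∀ σ → All (λ y → ¬ m ≡ y) σ → Unique (insertMax m σ)
  unique-insertMax []      _              = [] ∷ []
  unique-insertMax (x ∷ σ) (m≢x ∷ m∉σ) =
    All.tabulate frontDiffers ∷ UniqueP.map⁺ ∷-injectiveʳ (unique-insertMax σ m∉σ)
    where
    frontDiffers : ∀ {ρ} → ρ ∈ map (x ∷_) (insertMax m σ) → ¬ (m ∷ x ∷ σ) ≡ ρ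
    frontDiffers ρ∈ e with ∈-map⁻ (x ∷_) ρ∈
    ... | _ , _ , refl = m≢x (∷-injectiveˡ e)

pigeonhole : ∀ w S → Unique w → All (_∈ S) w → length w ≤ length S
pigeonhole []      S _              _              = z≤n
pigeonhole (x ∷ w) S (x∉w ∷ uw) (x∈S ∷ w⊆S) =
  ≤-trans (s≤s (pigeonhole w (filter ≢x? S) uw w⊆S-x)) (filter-notAll ≢x? S (Any.map (λ { refl x≢x → x≢x refl }) x∈S))
  where
  ≢x? = λ y → ¬? (x ℕ.≟ y)
  w⊆S-x : All (_∈ filter ≢x? S) w
  w⊆S-x = All.zipWith (λ (x≢y , y∈S) → ∈-filter⁺ ≢x? y∈S x≢y) (x∉w , w⊆S)

All-delete : ∀ {P : ℕ → Set} α x β → All P (α ++ x ∷ β) → All P (α ++ β)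
All-delete []      x β (_ ∷ Pβ) = Pβ
All-delete (y ∷ α) x β (Py ∷ P) = Py ∷ All-delete α x β P

All-middle : ∀ {P : ℕ → Set} α x β → All P (α ++ x ∷ β) → P x
All-middle []      x β (Px ∷ _) = Px
All-middle (y ∷ α) x β (_ ∷ P)  = All-middle α x β P

unique-delete : ∀ (α : List ℕ) (x : ℕ) β → Unique (α ++ x ∷ β) → Unique (α ++ β) × All (λ y → ¬ x ≡ y) (α ++ β)
unique-delete []      x β (x∉β ∷ uβ) = uβ , x∉β
unique-delete (y ∷ α) x β (y∉ ∷ u)   =
  let (u' , x∉) = unique-delete α x β u in
  (All-delete α x β y∉ ∷ u') , ((λ x≡y → All-middle α x β y∉ (sym x≡y)) ∷ x∉)

-- 𝔖_(N+1) consists exactly of the insertions of N + 1 into the σ ∈ 𝔖_N: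
-- a permutation of [N+1] must contain N + 1 (pigeonhole), and deleting it
-- leaves a permutation of [N].
Sym-suc⇔ : ∀ N w → w ∈ Sym (suc N) ⇔ w ∈ concatMap (insertMax (suc N)) (Sym N)
Sym-suc⇔ N w = mk⇔ to from
  where
  from : w ∈ concatMap (insertMax (suc N)) (Sym N) → w ∈ Sym (suc N)
  from w∈ with concatMap⁻ (insertMax (suc N)) (Sym N) w∈
  ... | σ , σ∈ , w∈ins with Sym⁻ N σ σ∈
  ...   | len , letters , uσ = Sym⁺ (suc N) w
          ( trans (length-insertMax (suc N) σ w∈ins) (cong suc len)
          , All-insertMax (suc N) σ (range⁺ (s≤s z≤n) ≤-refl) (All.map range-suc letters) w∈ins
          , unique-insertMax-elem (suc N) σ (All.map range-new letters) uσ w∈ins)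
  to : w ∈ Sym (suc N) → w ∈ concatMap (insertMax (suc N)) (Sym N)
  to w∈ with Sym⁻ (suc N) w w∈
  ... | len , letters , uw with any? (λ y → suc N ℕ.≟ y) w
  ...   | no N+1∉w = ⊥-elim (<-irrefl refl (≤-trans (≤-reflexive (sym len))
                      (≤-trans (pigeonhole w (range N) uw inRangeN) (≤-reflexive (length-range N)))))
    where
    inRangeN : All (_∈ range N) w
    inRangeN = All.zipWith (λ (y∈ , y≢) → range-pred y∈ y≢) (letters , ¬Any⇒All¬ w N+1∉w)
  ...   | yes N+1∈w with ∈-∃++ N+1∈w
  ...     | α , β , refl =
    let (uσ , N+1∉σ) = unique-delete α (suc N) β uw
        lettersσ = All.zipWith (λ (y∈ , y≢) → range-pred y∈ y≢) (All-delete α (suc N) β letters , N+1∉σ)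
        lenσ : length (α ++ β) ≡ N
        lenσ = suc-injective (trans (trans (cong suc (length-++ α)) (sym (+-suc (length α) (length β))))
                                    (trans (sym (length-++ α)) len))
    in concatMap⁺ (insertMax (suc N)) (Sym⁺ N (α ++ β) (lenσ , lettersσ , uσ)) (insertMax-complete (suc N) α β)

-- Both lists are duplicate-free, so they are permutations of each other.
Sym-suc↭ : ∀ N → Sym (suc N) ↭ concatMap (insertMax (suc N)) (Sym N)
Sym-suc↭ N = ∼bag⇒↭ (unique∧set⇒bag (unique-Sym (suc N)) unique-insertions (λ {w} → Sym-suc⇔ N w))
  where
  fresh : ∀ {σ} → σ ∈ Sym N → All (λ y → ¬ suc N ≡ y) σ
  fresh {σ} σ∈ = All.map range-new (proj₁ (proj₂ (Sym⁻ N σ σ∈)))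
  unique-insertions : Unique (concatMap (insertMax (suc N)) (Sym N))
  unique-insertions = unique-concatMap (insertMax (suc N)) (Sym N) (unique-Sym N)
    (λ {σ} σ∈ → unique-insertMax (suc N) σ (fresh σ∈))
    (λ {σ} {σ'} σ∈ σ'∈ ρ∈ ρ∈' → trans (sym (deleteMax-insertMax (suc N) σ (fresh σ∈) ρ∈))
                                       (deleteMax-insertMax (suc N) σ' (fresh σ'∈) ρ∈'))

length-filter-concatMap : ∀ {A B : Set} {P : B → Set} (P? : ∀ b → Dec (P b)) (f : A → List B) xs →
  length (filter P? (concatMap f xs)) ≡ sumOver (λ x → length (filter P? (f x))) xs
length-filter-concatMap P? f []       = refl
length-filter-concatMap P? f (x ∷ xs) rewrite filter-++ P? (f x) (concatMap f xs)
  | length-++ (filter P? (f x)) {filter P? (concatMap f xs)} =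
  cong (_+_ (length (filter P? (f x)))) (length-filter-concatMap P? f xs)

length-filter-occ : ∀ (S : List ℕ → ℕ) k l → length (filter (λ w → S w ℕ.≟ k) l) ≡ occ k (map S l)
length-filter-occ S k []      = refl
length-filter-occ S k (w ∷ l) with S w ≡ᵇ k
... | true  = cong suc (length-filter-occ S k l)
... | false = length-filter-occ S k l

countStat-occ : ∀ S n k → countStat S n k ≡ occ k (map S (Sym n))
countStat-occ S n k = length-filter-occ S k (Sym n)

countStat-suc : ∀ S N k → countStat S (suc N) k ≡ sumOver (λ σ → occ k (map S (insertMax (suc N) σ))) (Sym N)
countStat-suc S N k = begin
  length (filter S≟k (Sym (suc N)))
    ≡⟨ ↭-length (filter-↭ S≟k (Sym-suc↭ N)) ⟩
  length (filter S≟k (concatMap (insertMax (suc N)) (Sym N)))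
    ≡⟨ length-filter-concatMap S≟k (insertMax (suc N)) (Sym N) ⟩
  sumOver (λ σ → length (filter S≟k (insertMax (suc N) σ))) (Sym N)
    ≡⟨ cong sum (map-cong (λ σ → length-filter-occ S k (insertMax (suc N) σ)) (Sym N)) ⟩
  sumOver (λ σ → occ k (map S (insertMax (suc N) σ))) (Sym N) ∎
  where
  open ≡-Reasoning
  S≟k = λ w → S w ℕ.≟ k

δ : ℕ → ℕ → ℕ
δ a k = if a ≡ᵇ k then 1 else 0

occ-shift : ∀ v k d → All (_≤ 2) d → occ k (map (v +_) d) ≡ δ v k * occ 0 d + δ (1 + v) k * occ 1 d + δ (2 + v) k * occ 2 d
occ-shift v k [] [] rewrite *-zeroʳ (δ v k) | *-zeroʳ (δ (1 + v) k) | *-zeroʳ (δ (2 + v) k) = refl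
occ-shift v k (zero ∷ d) (_ ∷ ≤2) rewrite +-identityʳ v | occ-shift v k d ≤2 =
  arith (δ v k) (δ (1 + v) k) (δ (2 + v) k) (occ 0 d) (occ 1 d) (occ 2 d)
  where
  arith : ∀ A B C z o t → A + (A * z + B * o + C * t) ≡ A * (1 + z) + B * o + C * t
  arith = solve-∀
occ-shift v k (suc zero ∷ d) (_ ∷ ≤2) rewrite +-comm v 1 | occ-shift v k d ≤2 =
  arith (δ v k) (δ (1 + v) k) (δ (2 + v) k) (occ 0 d) (occ 1 d) (occ 2 d)
  where
  arith : ∀ A B C z o t → B + (A * z + B * o + C * t) ≡ A * z + B * (1 + o) + C * t
  arith = solve-∀
occ-shift v k (suc (suc zero) ∷ d) (_ ∷ ≤2) rewrite +-comm v 2 | occ-shift v k d ≤2 =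
  arith (δ v k) (δ (1 + v) k) (δ (2 + v) k) (occ 0 d) (occ 1 d) (occ 2 d)
  where
  arith : ∀ A B C z o t → C + (A * z + B * o + C * t) ≡ A * z + B * o + C * (1 + t)
  arith = solve-∀
occ-shift v k (suc (suc (suc e)) ∷ d) (s≤s (s≤s ()) ∷ ≤2)

occ-total : ∀ d → All (_≤ 2) d → occ 0 d + occ 1 d + occ 2 d ≡ length d
occ-total [] [] = refl
occ-total (zero ∷ d) (_ ∷ ≤2) = cong suc (occ-total d ≤2)
occ-total (suc zero ∷ d) (_ ∷ ≤2) = trans (arith (occ 0 d) (occ 1 d) (occ 2 d)) (cong suc (occ-total d ≤2))
  where
  arith : ∀ z o t → z + suc o + t ≡ suc (z + o + t)
  arith = solve-∀
occ-total (suc (suc zero) ∷ d) (_ ∷ ≤2) = trans (arith (occ 0 d) (occ 1 d) (occ 2 d)) (cong suc (occ-total d ≤2))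
  where
  arith : ∀ z o t → z + o + suc t ≡ suc (z + o + t)
  arith = solve-∀
occ-total (suc (suc (suc e)) ∷ d) (s≤s (s≤s ()) ∷ ≤2)

occ2-of-≤1 : ∀ d → All (_≤ 1) d → occ 2 d ≡ 0
occ2-of-≤1 [] [] = refl
occ2-of-≤1 (zero ∷ d) (_ ∷ ≤1) = occ2-of-≤1 d ≤1
occ2-of-≤1 (suc zero ∷ d) (_ ∷ ≤1) = occ2-of-≤1 d ≤1
occ2-of-≤1 (suc (suc e) ∷ d) (s≤s () ∷ ≤1)

≤1⇒≤2 : ∀ {d} → All (_≤ 1) d → All (_≤ 2) d
≤1⇒≤2 = All.map (λ p → ≤-trans p (n≤1+n 1))

occ1-from : ∀ d L z t → All (_≤ 2) d → length d ≡ L → occ 0 d ≡ z → occ 2 d ≡ t → occ 1 d ≡ L ∸ z ∸ t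
occ1-from d L z t ≤2 eL ez et = begin
  occ 1 d ≡⟨ sym (m+n∸m≡n (z + t) (occ 1 d)) ⟩
  z + t + occ 1 d ∸ (z + t) ≡⟨ cong (_∸ (z + t)) (trans (arith z t (occ 1 d)) (trans (cong₂ (λ p q → p + occ 1 d + q) (sym ez) (sym et)) (trans (occ-total d ≤2) eL))) ⟩
  L ∸ (z + t) ≡⟨ sym (∸-+-assoc L z t) ⟩
  L ∸ z ∸ t ∎
  where
  open ≡-Reasoning
  arith : ∀ z t o → z + t + o ≡ z + o + t
  arith = solve-∀

occ2-from : ∀ d L z o → All (_≤ 2) d → length d ≡ L → occ 0 d ≡ z → occ 1 d ≡ o → occ 2 d ≡ L ∸ z ∸ o
occ2-from d L z o ≤2 eL ez eo = begin
  occ 2 d ≡⟨ sym (m+n∸m≡n (z + o) (occ 2 d)) ⟩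
  z + o + occ 2 d ∸ (z + o) ≡⟨ cong (_∸ (z + o)) (trans (cong₂ (λ p q → p + q + occ 2 d) (sym ez) (sym eo)) (trans (occ-total d ≤2) eL)) ⟩
  L ∸ (z + o) ≡⟨ sym (∸-+-assoc L z o) ⟩
  L ∸ z ∸ o ∎
  where open ≡-Reasoning

unique⇒distinct : ∀ w → Unique w → NeighboursDistinct w
unique⇒distinct [] _ = tt
unique⇒distinct (x ∷ []) _ = tt
unique⇒distinct (x ∷ y ∷ w) ((x≢y ∷ _) ∷ u) = x≢y , unique⇒distinct (y ∷ w) u

distinct-0∷ : ∀ {N} w → All (_∈ range N) w → NeighboursDistinct w → NeighboursDistinct (0 ∷ w)
distinct-0∷ [] _ _ = tt
distinct-0∷ {N} (x ∷ w) (x∈ ∷ _) neighbours = (λ 0≡x → <-irrefl 0≡x (proj₁ (range⁻ {N} x∈))) , neighbours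

range⇒< : ∀ {N} w → All (_∈ range N) w → All (_< suc N) w
range⇒< w letters = All.map (λ y∈ → s≤s (proj₂ (range⁻ y∈))) letters

length-signature : ∀ x w → length (signature (x ∷ w)) ≡ length w
length-signature x [] = refl
length-signature x (y ∷ w) = cong suc (length-signature y w)

module Recurrence (S : List ℕ → ℕ) (N : ℕ) (Z O T : ℕ → ℕ)
  (local : ∀ σ → σ ∈ Sym N → ∀ k →
           occ k (map S (insertMax (suc N) σ)) ≡ δ (S σ) k * Z (S σ) + δ (1 + S σ) k * O (S σ) + δ (2 + S σ) k * T (S σ))
  where

  distribution : ℕ → ℕ → ℕ
  distribution n k = occ k (map S (Sym n))

  sum-δ : ∀ (F : ℕ → ℕ) k (l : List (List ℕ)) → sumOver (λ σ → δ (S σ) k * F (S σ)) l ≡ F k * occ k (map S l)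
  sum-δ F k [] = sym (*-zeroʳ (F k))
  sum-δ F k (σ ∷ l) with S σ ℕ.≟ k
  ... | yes refl rewrite ≡ᵇ-true {S σ} refl | sum-δ F (S σ) l = lemma (F (S σ)) (occ (S σ) (map S l))
    where
    lemma : ∀ a b → a + 0 + a * b ≡ a * (1 + b)
    lemma = solve-∀
  ... | no S≢k rewrite ≡ᵇ-false S≢k = sum-δ F k l

  fromBelow₁ fromBelow₂ : ℕ → ℕ
  fromBelow₁ zero    = 0
  fromBelow₁ (suc k) = O k * distribution N k
  fromBelow₂ zero          = 0
  fromBelow₂ (suc zero)    = 0
  fromBelow₂ (suc (suc k)) = T k * distribution N k

  recurrence : ∀ k → distribution (suc N) k ≡ Z k * distribution N k + fromBelow₁ k + fromBelow₂ k
  recurrence k = begin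
    distribution (suc N) k
      ≡⟨ sym (countStat-occ S (suc N) k) ⟩
    countStat S (suc N) k
      ≡⟨ countStat-suc S N k ⟩
    sumOver (λ σ → occ k (map S (insertMax (suc N) σ))) (Sym N)
      ≡⟨ sumOver-cong (Sym N) (All.tabulate (λ {σ} σ∈ → local σ σ∈ k)) ⟩
    sumOver (λ σ → same σ + up₁ σ + up₂ σ) (Sym N)
      ≡⟨ trans (sumOver-+ (λ σ → same σ + up₁ σ) up₂ (Sym N)) (cong (_+ sumOver up₂ (Sym N)) (sumOver-+ same up₁ (Sym N))) ⟩
    sumOver same (Sym N) + sumOver up₁ (Sym N) + sumOver up₂ (Sym N)
      ≡⟨ cong₂ _+_ (cong₂ _+_ (sum-δ Z k (Sym N)) (sum-up₁ k)) (sum-up₂ k) ⟩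
    Z k * distribution N k + fromBelow₁ k + fromBelow₂ k ∎
    where
    open ≡-Reasoning
    same up₁ up₂ : List ℕ → ℕ
    same σ = δ (S σ) k * Z (S σ)
    up₁  σ = δ (1 + S σ) k * O (S σ)
    up₂  σ = δ (2 + S σ) k * T (S σ)
    sum-up₁ : ∀ k → sumOver (λ σ → δ (1 + S σ) k * O (S σ)) (Sym N) ≡ fromBelow₁ k
    sum-up₁ zero    = sumOver-0 (Sym N)
    sum-up₁ (suc k) = sum-δ O k (Sym N)
    sum-up₂ : ∀ k → sumOver (λ σ → δ (2 + S σ) k * T (S σ)) (Sym N) ≡ fromBelow₂ k
    sum-up₂ zero          = sumOver-0 (Sym N)
    sum-up₂ (suc zero)    = sumOver-0 (Sym N)
    sum-up₂ (suc (suc k)) = sum-δ T k (Sym N)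

local-count : ∀ (S : List ℕ → ℕ) m σ d → map S (insertMax m σ) ≡ map (S σ +_) d → All (_≤ 2) d →
  ∀ {z o t} → occ 0 d ≡ z → occ 1 d ≡ o → occ 2 d ≡ t → ∀ k →
  occ k (map S (insertMax m σ)) ≡ δ (S σ) k * z + δ (1 + S σ) k * o + δ (2 + S σ) k * t
local-count S m σ d eq ≤2 refl refl refl k = trans (cong (occ k) eq) (occ-shift (S σ) k d ≤2)

lpk-local : ∀ N σ → σ ∈ Sym N → ∀ k → occ k (map lpk (insertMax (suc N) σ)) ≡
  δ (lpk σ) k * (1 + 2 * lpk σ) + δ (1 + lpk σ) k * (N ∸ 2 * lpk σ) + δ (2 + lpk σ) k * 0
lpk-local N σ σ∈ with Sym⁻ N σ σ∈
... | len , inRange , unique = local-count lpk (suc N) σ d eq ≤2 zeros ones twos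
  where
  neighbours = distinct-0∷ σ inRange (unique⇒distinct σ unique)
  s = signature (0 ∷ σ)
  d = Δpeaks₀ s
  ≤2 = ≤1⇒≤2 (Δpeaks₀≤1 s)
  lpk≡ : peaksˢ s ≡ lpk σ
  lpk≡ = sym (peaks-signature (0 ∷ σ) neighbours)
  eq : map lpk (insertMax (suc N) σ) ≡ map (lpk σ +_) d
  eq = trans (lpk-insertMax (suc N) σ (s≤s z≤n) (range⇒< σ inRange) neighbours) (cong (λ q → map (q +_) d) lpk≡)
  zeros : occ 0 d ≡ 1 + 2 * lpk σ
  zeros = trans (occ0-Δpeaks₀ s) (cong (λ q → 1 + 2 * q) lpk≡)
  twos : occ 2 d ≡ 0
  twos = occ2-of-≤1 d (Δpeaks₀≤1 s)
  ones : occ 1 d ≡ N ∸ 2 * lpk σ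
  ones = occ1-from d (suc N) _ _ ≤2 (trans (length-Δpeaks₀ s) (cong suc (trans (length-signature 0 σ) len))) zeros twos

ipk-local : ∀ n σ → σ ∈ Sym (suc n) → ∀ k → occ k (map ipk (insertMax (suc (suc n)) σ)) ≡
  δ (ipk σ) k * (2 + 2 * ipk σ) + δ (1 + ipk σ) k * (n ∸ 2 * ipk σ) + δ (2 + ipk σ) k * 0
ipk-local n [] σ∈ with Sym⁻ (suc n) [] σ∈
... | () , _
ipk-local n (x ∷ τ) σ∈ with Sym⁻ (suc n) (x ∷ τ) σ∈
... | len , inRange , unique = local-count ipk (suc (suc n)) (x ∷ τ) d eq (≤1⇒≤2 ≤1) zeros ones twos
  where
  neighbours = unique⇒distinct (x ∷ τ) unique
  s = signature (x ∷ τ)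
  d = 0 ∷ Δpeaks₀ s
  ≤1 : All (_≤ 1) d
  ≤1 = z≤n ∷ Δpeaks₀≤1 s
  ipk≡ : peaksˢ s ≡ ipk (x ∷ τ)
  ipk≡ = sym (peaks-signature (x ∷ τ) neighbours)
  eq : map ipk (insertMax (suc (suc n)) (x ∷ τ)) ≡ map (ipk (x ∷ τ) +_) d
  eq = trans (ipk-insertMax (suc (suc n)) x τ (range⇒< (x ∷ τ) inRange) neighbours) (cong (λ q → map (q +_) d) ipk≡)
  zeros : occ 0 d ≡ 2 + 2 * ipk (x ∷ τ)
  zeros = cong suc (trans (occ0-Δpeaks₀ s) (cong (λ q → 1 + 2 * q) ipk≡))
  twos : occ 2 d ≡ 0
  twos = occ2-of-≤1 d ≤1
  ones : occ 1 d ≡ n ∸ 2 * ipk (x ∷ τ)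
  ones = occ1-from d (suc (suc n)) _ _ (≤1⇒≤2 ≤1)
           (cong suc (trans (length-Δpeaks₀ s) (trans (cong suc (length-signature x τ)) len))) zeros twos

runs-local : ∀ n σ → σ ∈ Sym (suc (suc n)) → ∀ k → occ k (map runs (insertMax (suc (suc (suc n))) σ)) ≡
  δ (runs σ) k * runs σ + δ (1 + runs σ) k * 2 + δ (2 + runs σ) k * (suc (suc (suc n)) ∸ runs σ ∸ 2)
runs-local n σ σ∈ with Sym⁻ (suc (suc n)) σ σ∈
runs-local n (x ∷ y ∷ τ) σ∈ | len , inRange , unique = local-count runs _ (x ∷ y ∷ τ) d eq ≤2 zeros ones twos
  where
  neighbours = unique⇒distinct (x ∷ y ∷ τ) unique
  s = signature (x ∷ y ∷ τ)
  d = b2n (x <ᵇ y) ∷ Δchanges₀ s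
  ≤2 : All (_≤ 2) d
  ≤2 = b2n≤2 (x <ᵇ y) ∷ Δchanges₀≤2 s
    where
    b2n≤2 : ∀ b → b2n b ≤ 2
    b2n≤2 true  = s≤s z≤n
    b2n≤2 false = z≤n
  runs≡ : suc (changesˢ s) ≡ runs (x ∷ y ∷ τ)
  runs≡ = cong suc (sym (changes-signature (x ∷ y ∷ τ) neighbours))
  eq : map runs (insertMax _ (x ∷ y ∷ τ)) ≡ map (runs (x ∷ y ∷ τ) +_) d
  eq = trans (runs-insertMax _ x y τ (range⇒< (x ∷ y ∷ τ) inRange) neighbours) (cong (λ q → map (q +_) d) runs≡)
  zeros : occ 0 d ≡ runs (x ∷ y ∷ τ)
  zeros = trans (occ0-runs-increments (x <ᵇ y) (signature (y ∷ τ))) runs≡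
  ones : occ 1 d ≡ 2
  ones = occ1-runs-increments (x <ᵇ y) (signature (y ∷ τ))
  twos : occ 2 d ≡ suc (suc (suc n)) ∸ runs (x ∷ y ∷ τ) ∸ 2
  twos = occ2-from d _ _ _ ≤2
           (cong (suc ∘ suc) (trans (length-Δchanges (x <ᵇ y) (signature (y ∷ τ)))
                                    (trans (cong suc (length-signature y τ)) (suc-injective len)))) zeros ones

insertMax-cons : ∀ m σ → All (λ ρ → ∃ λ z → ∃ λ ρ' → ρ ≡ z ∷ ρ') (insertMax m σ)
insertMax-cons m []      = (m , [] , refl) ∷ []
insertMax-cons m (x ∷ σ) = (m , x ∷ σ , refl) ∷ AllP.map⁺ (All.map (λ _ → x , _ , refl) (insertMax-cons m σ))

-- The longest alternating subsequences of the insertions, as "old value +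
-- increment", using as(ρ) = 1 + (direction changes of 0 ρ).
as-insertMax : ∀ m σ → 0 < m → All (_< m) σ → NeighboursDistinct (0 ∷ σ) →
  map as (insertMax m σ) ≡ map (suc (changesˢ (signature (0 ∷ σ))) +_) (Δchanges₀ (signature (0 ∷ σ)))
as-insertMax m σ 0<m <m neighbours = begin
  map as (insertMax m σ)
    ≡⟨ map-cong-local (All.zipWith (λ { (nb , z , ρ' , refl) → as-changes z ρ' nb })
                                    (distinct-insertMax-after m 0 σ 0<m <m neighbours , insertMax-cons m σ)) ⟩
  map (suc ∘ changesˢ ∘ (λ ρ → signature (0 ∷ ρ))) (insertMax m σ)
    ≡⟨ map-∘ (insertMax m σ) ⟩
  map (suc ∘ changesˢ) (map (λ ρ → signature (0 ∷ ρ)) (insertMax m σ))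
    ≡⟨ cong (map (suc ∘ changesˢ)) (signature-insertMax-after m 0 σ 0<m <m) ⟩
  map (suc ∘ changesˢ) (insertedSigs s)
    ≡⟨ map-∘ (insertedSigs s) ⟩
  map suc (map changesˢ (insertedSigs s))
    ≡⟨ cong (map suc) (Δchanges₀-correct s) ⟩
  map suc (map (changesˢ s +_) (Δchanges₀ s))
    ≡⟨ sym (map-∘ (Δchanges₀ s)) ⟩
  map (suc (changesˢ s) +_) (Δchanges₀ s) ∎
  where
  open ≡-Reasoning
  s = signature (0 ∷ σ)

-- Longest alternating subsequences: of the n + 2 insertions into
-- σ ∈ 𝔖_(n+1) with as σ = v, v leave it unchanged, 1 raises it by one and
-- the other n + 1 - v by two (as behaves like the runs of 0 σ).
as-local : ∀ n σ → σ ∈ Sym (suc n) → ∀ k → occ k (map as (insertMax (suc (suc n)) σ)) ≡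
  δ (as σ) k * as σ + δ (1 + as σ) k * 1 + δ (2 + as σ) k * (suc (suc n) ∸ as σ ∸ 1)
as-local n σ σ∈ with Sym⁻ (suc n) σ σ∈
as-local n []           σ∈ | () , _ , _
as-local n (zero ∷ τ)   σ∈ | _ , (0∈ ∷ _) , _ with range⁻ 0∈
... | () , _
as-local n (suc x ∷ τ) σ∈ | len , inRange , unique = local-count as m σ d eq ≤2 zeros ones twos
  where
  σ = suc x ∷ τ
  m = suc (suc n)
  neighbours = distinct-0∷ σ inRange (unique⇒distinct σ unique)
  s = signature σ
  d = Δchanges₀ (true ∷ s)
  ≤2 = Δchanges₀≤2 (true ∷ s)
  as≡ : suc (changesˢ (true ∷ s)) ≡ as σ
  as≡ = sym (as-changes (suc x) τ neighbours)
  eq : map as (insertMax m σ) ≡ map (as σ +_) d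
  eq = trans (as-insertMax m σ (s≤s z≤n) (range⇒< σ inRange) neighbours) (cong (λ q → map (q +_) d) as≡)
  zeros : occ 0 d ≡ as σ
  zeros = trans (occ0-as-increments s) as≡
  ones : occ 1 d ≡ 1
  ones = occ1-Δchanges₀-up s
  twos : occ 2 d ≡ suc (suc n) ∸ as σ ∸ 1
  twos = occ2-from d _ _ _ ≤2
           (cong suc (trans (length-Δchanges true s) (trans (cong suc (length-signature (suc x) τ)) len))) zeros ones

lpkDist ipkDist asDist runsDist : ℕ → ℕ → ℕ
lpkDist  n k = occ k (map lpk  (Sym n))
ipkDist  n k = occ k (map ipk  (Sym (suc n)))
asDist   n k = occ k (map as   (Sym n))
runsDist n k = occ k (map runs (Sym (suc n)))

module LpkRecurrence  (n : ℕ) = Recurrence lpk n (λ v → 1 + 2 * v) (λ v → n ∸ 2 * v) (λ _ → 0) (lpk-local n)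
module IpkRecurrence  (n : ℕ) = Recurrence ipk (suc n) (λ v → 2 + 2 * v) (λ v → n ∸ 2 * v) (λ _ → 0) (ipk-local n)
module AsRecurrence   (m : ℕ) = Recurrence as (suc m) (λ v → v) (λ _ → 1) (λ v → suc (suc m) ∸ v ∸ 1) (as-local m)
module RunsRecurrence (m : ℕ) =
  Recurrence runs (suc (suc m)) (λ v → v) (λ _ → 2) (λ v → suc (suc (suc m)) ∸ v ∸ 2) (runs-local m)

+0+0 : ∀ a → a + 0 + 0 ≡ a
+0+0 a = trans (+-identityʳ (a + 0)) (+-identityʳ a)

unit-coefficient : ∀ w a b → 1 * a + w * b + 0 ≡ a + w * b
unit-coefficient = solve-∀

∸-shift : ∀ j a k → j + a ∸ k ∸ j ≡ a ∸ k
∸-shift j a k = trans (∸-+-assoc (j + a) k j) (trans (cong (j + a ∸_) (+-comm k j)) ([m+n]∸[m+o]≡n∸o j a k))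

lpkDist-rec-0 : ∀ n → lpkDist (suc n) 0 ≡ 1 * lpkDist n 0
lpkDist-rec-0 n = trans (LpkRecurrence.recurrence n 0) (+0+0 _)

lpkDist-rec : ∀ n k → lpkDist (suc n) (suc k) ≡ (1 + 2 * suc k) * lpkDist n (suc k) + (n ∸ 2 * k) * lpkDist n k
lpkDist-rec n zero    = trans (LpkRecurrence.recurrence n 1) (+-identityʳ _)
lpkDist-rec n (suc k) = trans (LpkRecurrence.recurrence n (suc (suc k))) (+-identityʳ _)

ipkDist-rec-0 : ∀ n → ipkDist (suc n) 0 ≡ 2 * ipkDist n 0
ipkDist-rec-0 n = trans (IpkRecurrence.recurrence n 0) (+0+0 _)

ipkDist-rec : ∀ n k → ipkDist (suc n) (suc k) ≡ (2 + 2 * suc k) * ipkDist n (suc k) + (n ∸ 2 * k) * ipkDist n k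
ipkDist-rec n zero    = trans (IpkRecurrence.recurrence n 1) (+-identityʳ _)
ipkDist-rec n (suc k) = trans (IpkRecurrence.recurrence n (suc (suc k))) (+-identityʳ _)

asDist-rec-0 : ∀ n → 1 ≤ n → asDist (suc n) 0 ≡ 0
asDist-rec-0 (suc m) _ = AsRecurrence.recurrence m 0

asDist-rec-1 : ∀ n → 1 ≤ n → asDist (suc n) 1 ≡ asDist n 1 + 1 * asDist n 0
asDist-rec-1 (suc m) _ = trans (AsRecurrence.recurrence m 1) (unit-coefficient 1 (asDist (suc m) 1) (asDist (suc m) 0))

asDist-rec : ∀ n → 1 ≤ n → ∀ k → asDist (suc n) (suc (suc k))
             ≡ suc (suc k) * asDist n (suc (suc k)) + 1 * asDist n (suc k) + (n ∸ k) * asDist n k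
asDist-rec (suc m) _ k = trans (AsRecurrence.recurrence m (suc (suc k)))
  (cong (λ q → suc (suc k) * asDist (suc m) (suc (suc k)) + 1 * asDist (suc m) (suc k) + q * asDist (suc m) k)
        (∸-shift 1 (suc m) k))

runsDist-rec-0 : ∀ n → 1 ≤ n → runsDist (suc n) 0 ≡ 0
runsDist-rec-0 (suc m) _ = RunsRecurrence.recurrence m 0

runsDist-rec-1 : ∀ n → 1 ≤ n → runsDist (suc n) 1 ≡ runsDist n 1 + 2 * runsDist n 0
runsDist-rec-1 (suc m) _ = trans (RunsRecurrence.recurrence m 1) (unit-coefficient 2 (runsDist (suc m) 1) (runsDist (suc m) 0))

runsDist-rec : ∀ n → 1 ≤ n → ∀ k → runsDist (suc n) (suc (suc k))
               ≡ suc (suc k) * runsDist n (suc (suc k)) + 2 * runsDist n (suc k) + (n ∸ k) * runsDist n k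
runsDist-rec (suc m) _ k = trans (RunsRecurrence.recurrence m (suc (suc k)))
  (cong (λ q → suc (suc k) * runsDist (suc m) (suc (suc k)) + 2 * runsDist (suc m) (suc k) + q * runsDist (suc m) k)
        (∸-shift 2 (suc m) k))

-- The total coefficient sums: D multiplies the total of a degree-n
-- polynomial in W^w by w + n, so total D^n(W) = n! and total D^n(W²) = (n+1)!.

total-D^ : ∀ w n → total (Dℕ^ (suc n) (Wpow w)) ≡ (w + n) * total (Dℕ^ n (Wpow w))
total-D^ w n = total-D w n (Dℕ^ n (Wpow w)) (shaped-D^ w n)

total-W : ∀ n → total (Dℕ^ n (Wpow 1)) ≡ n !
total-W zero    = refl
total-W (suc n) = trans (total-D^ 1 n) (cong (suc n *_) (total-W n))

total-W² : ∀ n → total (Dℕ^ n (Wpow 2)) ≡ suc n !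
total-W² zero    = refl
total-W² (suc n) = trans (total-D^ 2 n) (cong (suc (suc n) *_) (total-W² n))

-- The index i of t_{n,i,j} corresponds to X-exponent 2i + (n mod 2); it is
-- in range exactly when i ≤ ⌊n/2⌋, and then ⌊n/2⌋ - i is the matching
-- index k of XMarginals.

xexp-in-range : ∀ n i → i ≤ n / 2 → xexp n i + 2 * (n / 2 ∸ i) ≡ n
xexp-in-range n i i≤ = begin
  2 * i + n % 2 + 2 * (n / 2 ∸ i) ≡⟨ reorder i (n % 2) (n / 2 ∸ i) ⟩
  n % 2 + (i + (n / 2 ∸ i)) * 2   ≡⟨ cong (λ q → n % 2 + q * 2) (m+[n∸m]≡n i≤) ⟩
  n % 2 + (n / 2) * 2             ≡⟨ sym (m≡m%n+[m/n]*n n 2) ⟩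
  n ∎
  where
  open ≡-Reasoning
  reorder : ∀ i r d → 2 * i + r + 2 * d ≡ r + (i + d) * 2
  reorder = solve-∀

xexp-out-of-range : ∀ n i → ¬ (i ≤ n / 2) → n < xexp n i
xexp-out-of-range n i i≰ = begin-strict
  n                      ≡⟨ m≡m%n+[m/n]*n n 2 ⟩
  n % 2 + (n / 2) * 2    ≤⟨ +-monoˡ-≤ ((n / 2) * 2) (≤-pred (m%n<n n 2)) ⟩
  1 + (n / 2) * 2        <⟨ ≤-reflexive (reorder (n / 2)) ⟩
  2 * suc (n / 2)        ≤⟨ *-monoʳ-≤ 2 (≰⇒> i≰) ⟩
  2 * i                  ≤⟨ m≤m+n (2 * i) (n % 2) ⟩
  2 * i + n % 2 ∎
  where
  open ≤-Reasoning
  reorder : ∀ q → suc (1 + q * 2) ≡ 2 * suc q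
  reorder = solve-∀

≤ᵇ-sound : ∀ {i m} → (i ≤ᵇ m) ≡ true → i ≤ m
≤ᵇ-sound {i} {m} e = ≤ᵇ⇒≤ i m (subst T (sym e) tt)

≤ᵇ-complete : ∀ {i m} → (i ≤ᵇ m) ≡ false → ¬ i ≤ m
≤ᵇ-complete {i} {m} e i≤m with ≤⇒≤ᵇ i≤m
... | i≤ᵇm rewrite e = i≤ᵇm

module LpkMarginals  = XMarginals 1 lpkDist refl (λ _ → refl) lpkDist-rec-0 lpkDist-rec
module IpkMarginals  = XMarginals 2 ipkDist refl (λ _ → refl) ipkDist-rec-0 ipkDist-rec
module AsMarginals   = YMarginals 1 asDist refl refl (λ _ → refl) asDist-rec-0 asDist-rec-1 asDist-rec
module RunsMarginals = YMarginals 2 runsDist refl refl (λ _ → refl) runsDist-rec-0 runsDist-rec-1 runsDist-rec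

xMarginal-lpk : ∀ n i → xMarginal (xexp n i) (Dℕ^ n (Wpow 1)) ≡ at- (P̃ n) (n / 2) i
xMarginal-lpk n i with i ≤ᵇ n / 2 in i≤?
... | true  = trans (LpkMarginals.xMarginal≡ n (xexp n i) (n / 2 ∸ i) (xexp-in-range n i (≤ᵇ-sound i≤?)))
                    (sym (countStat-occ lpk n _))
... | false = xMarginal-vanish 1 n (xexp n i) _ (shaped-D^ 1 n) (xexp-out-of-range n i (≤ᵇ-complete i≤?))

xMarginal-ipk : ∀ n i → xMarginal (xexp n i) (Dℕ^ n (Wpow 2)) ≡ at- (P (suc n)) (n / 2) i
xMarginal-ipk n i with i ≤ᵇ n / 2 in i≤?
... | true  = trans (IpkMarginals.xMarginal≡ n (xexp n i) (n / 2 ∸ i) (xexp-in-range n i (≤ᵇ-sound i≤?)))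
                    (sym (countStat-occ ipk (suc n) _))
... | false = xMarginal-vanish 2 n (xexp n i) _ (shaped-D^ 2 n) (xexp-out-of-range n i (≤ᵇ-complete i≤?))

yMarginal-as : ∀ m j → yMarginal j (Dℕ^ (suc m) (Wpow 1)) ≡ at- (λ k → a k (suc m)) (suc m) j
yMarginal-as m j with j ≤ᵇ suc m in j≤?
... | true  = trans (AsMarginals.yMarginal≡ m j (suc m ∸ j) (m+[n∸m]≡n (≤ᵇ-sound {j} j≤?)))
                    (sym (countStat-occ as (suc m) _))
... | false = yMarginal-vanish 1 (suc m) j _ (shaped-D^ 1 (suc m)) (≰⇒> (≤ᵇ-complete j≤?))

yMarginal-runs : ∀ m j → yMarginal j (Dℕ^ (suc m) (Wpow 2)) ≡ at- (R (suc (suc m))) (suc m) j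
yMarginal-runs m j with j ≤ᵇ suc m in j≤?
... | true  = trans (RunsMarginals.yMarginal≡ m j (suc m ∸ j) (m+[n∸m]≡n (≤ᵇ-sound {j} j≤?)))
                    (sym (countStat-occ runs (suc (suc m)) _))
... | false = yMarginal-vanish 2 (suc m) j _ (shaped-D^ 2 (suc m)) (≰⇒> (≤ᵇ-complete j≤?))

open Int using (+_)

Σ<-+ : ∀ N (f : ℕ → ℕ) → Σ< N (λ i → + f i) ≡ + Σℕ N f
Σ<-+ zero    f = refl
Σ<-+ (suc N) f rewrite Σ<-+ N f = refl

Σ<-cong : ∀ N {f g : ℕ → ℤ} → (∀ i → f i ≡ g i) → Σ< N f ≡ Σ< N g
Σ<-cong zero    f≗g = refl
Σ<-cong (suc N) f≗g = cong₂ Int._+_ (Σ<-cong N f≗g) (f≗g N)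

module CoefficientArray (w : ℕ) (c : ℕ → ℕ → ℕ → ℤ)
  (c≡ : ∀ n i j → c n i j ≡ + coeffXℕ w (Dℕ^ n (Wpow w)) n (xexp n i) j) where

  private
    p : ℕ → Polyℕ
    p n = Dℕ^ n (Wpow w)

  row-sum : ∀ n i → Σ< (suc n) (λ j → c n i j) ≡ + xMarginal (xexp n i) (p n)
  row-sum n i = trans (Σ<-cong (suc n) (c≡ n i)) (trans (Σ<-+ (suc n) _) (cong +_ (Σⱼ-coeffX w n (xexp n i) (p n) (shaped-D^ w n))))

  column-sum : ∀ n j → Σ< (suc n) (λ i → c n i j) ≡ + yMarginal j (p n)
  column-sum n j = trans (Σ<-cong (suc n) (λ i → c≡ n i j)) (trans (Σ<-+ (suc n) _) (cong +_ (Σᵢ-coeffX w n j (p n) (shaped-D^ w n))))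

  total-sum : ∀ n → Σ< (suc n) (λ i → Σ< (suc n) (λ j → c n i j)) ≡ + total (p n)
  total-sum n = trans (Σ<-cong (suc n) (row-sum n)) (trans (Σ<-+ (suc n) _) (cong +_ (Σᵢ-xMarginal w n (p n) (shaped-D^ w n))))

module TArray = CoefficientArray 1 t t≡coeffXℕ
module RArray = CoefficientArray 2 r r≡coeffXℕ

theorem4p4 : (n : ℕ) → 1 ≤ n →
    ((Σ< (suc n) λ i → Σ< (suc n) λ j → t n i j) ≡ + (n !)
    × (Σ< n λ i → Σ< n λ j → r (n ∸ 1) i j) ≡ + (n !))
    × (∀ j → (Σ< (suc n) λ i → t n i j) ≡ + at- (λ k → a k n) n j)
    × (∀ i → (Σ< (suc n) λ j → t n i j) ≡ + at- (P̃ n) (n / 2) i)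
    × (∀ j → (Σ< (suc n) λ i → r n i j) ≡ + at- (R (suc n)) n j)
    × (∀ i → (Σ< (suc n) λ j → r n i j) ≡ + at- (P (suc n)) (n / 2) i)
theorem4p4 (suc m) _ =
  ( trans (TArray.total-sum (suc m)) (cong +_ (total-W (suc m)))
  , trans (RArray.total-sum m) (cong +_ (total-W² m)) )
  , (λ j → trans (TArray.column-sum (suc m) j) (cong +_ (yMarginal-as m j)))
  , (λ i → trans (TArray.row-sum (suc m) i) (cong +_ (xMarginal-lpk (suc m) i)))
  , (λ j → trans (RArray.column-sum (suc m) j) (cong +_ (yMarginal-runs m j)))
  , (λ i → trans (RArray.row-sum (suc m) i) (cong +_ (xMarginal-ipk (suc m) i)))
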